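{- Let $U$ be the set of natural numbers $n$ whose $\varphi$-representation contains exactly one odd exponent. Then the set of Zeckendorf representations of elements of $U$ is accepted by a deterministic finite automaton (i.e. is a regular language). Furthermore, a natural number $n$ lies in $U$ if and only if $n-2$ is a (possibly empty) sum of distinct even-indexed Lucas numbers $L_{2i}$ with $i \ge 2$. Finally, for every $n \in U$, the unique odd exponent in its $\varphi$-representation equals $1$.
   Context: $\varphi = (1+\sqrt{5})/2$. Every real $x \ge 0$ has a unique $\varphi$-representation $x = \sum_{i \le t} e_i \varphi^i$ with $e_i \in \{0,1\}$, $e_i e_{i+1} = 0$ for all $i$, and no infinite tail $1010\cdots$; for natural numbers it is finite. The exponents of the representation are the $i$ with $e_i = 1$. Lucas numbers: $L_0 = 2$, $L_1 = 1$, $L_k = L_{k-1} + L_{k-2}$. The Zeckendorf representation of $n$ is the unique binary string $b_t \cdots b_2$ (no leading zero, no two adjacent $1$s) with $n = \sum_{i=2}^t b_i F_i$, where $F_i$ are the Fibonacci numbers ($F_0=0,F_1=1$). -}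

module Defs where

open import Data.Nat as ℕ using (ℕ; zero; suc; _%_; _≡ᵇ_)
open import Data.Integer as ℤ using (ℤ; +_; -[1+_]; ∣_∣)
open import Data.Bool using (Bool; true; false; if_then_else_)
open import Data.List using (List; []; _∷_; length; filter; map)
open import Data.List.Relation.Unary.Linked using (Linked)
open import Data.List.Relation.Unary.All using (All)
open import Data.List.Relation.Unary.Unique.Propositional using (Unique)
open import Data.List.Membership.Propositional using (_∈_)
open import Data.Product using (Σ; _×_; ∃)
open import Data.Fin using (Fin)
open import Relation.Binary.PropositionalEquality using (_≡_)
open import Relation.Nullary using (¬_)
open import Data.Bool using (T)

fib : ℕ → ℕ
fib 0 = 0
fib 1 = 1
fib (suc (suc n)) = fib (suc n) ℕ.+ fib n

lucas : ℕ → ℕ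
lucas 0 = 2
lucas 1 = 1
lucas (suc (suc n)) = lucas (suc n) ℕ.+ lucas n

-- The ring ℤ[φ] (φ² = φ + 1): the pair (a , b) stands for a + b·φ.
-- Since φ is irrational, two elements of ℤ[φ] are equal as reals iff
-- their coordinates agree, so sums of powers of φ can be compared exactly.

record ℤφ : Set where
  constructor _+_φ
  field
    re : ℤ
    im : ℤ

open ℤφ public

_⊕_ : ℤφ → ℤφ → ℤφ
(a + b φ) ⊕ (c + d φ) = (a ℤ.+ c) + (b ℤ.+ d) φ

mulφ : ℤφ → ℤφ
mulφ (a + b φ) = b + (a ℤ.+ b) φ

-- division by φ : (a + bφ)/φ = a(φ - 1) + b = (b - a) + aφ
divφ : ℤφ → ℤφ
divφ (a + b φ) = (b ℤ.- a) + a φ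

iter : (ℤφ → ℤφ) → ℕ → ℤφ → ℤφ
iter f zero x = x
iter f (suc n) x = f (iter f n x)

one : ℤφ
one = (+ 1) + (+ 0) φ

φ^ : ℤ → ℤφ
φ^ (+ n) = iter mulφ n one
φ^ -[1+ n ] = iter divφ (suc n) one

ℕ→ℤφ : ℕ → ℤφ
ℕ→ℤφ n = (+ n) + (+ 0) φ

sumφ : List ℤ → ℤφ
sumφ [] = (+ 0) + (+ 0) φ
sumφ (i ∷ is) = φ^ i ⊕ sumφ is

-- A representation is given by its list of exponents, listed in strictly
-- decreasing order with consecutive exponents differing by at least 2
-- (i.e. e_i e_{i+1} = 0); its value is Σ φ^i.

Gap : ℤ → ℤ → Set
Gap i j = j ℤ.+ (+ 2) ℤ.≤ i

IsPhiRep : List ℤ → ℕ → Set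
IsPhiRep es n = Linked Gap es × sumφ es ≡ ℕ→ℤφ n

oddℤ : ℤ → Bool
oddℤ i = (∣ i ∣ % 2) ≡ᵇ 1

#odd : List ℤ → ℕ
#odd es = length (filter (λ i → T? (oddℤ i)) es)
  where
  open import Relation.Nullary.Decidable using (Dec)
  open import Data.Bool.Properties using (T?)

InU : ℕ → Set
InU n = Σ (List ℤ) λ es → IsPhiRep es n × #odd es ≡ 1

-- Zeckendorf representations: a bit string b_t ⋯ b_2 (most significant
-- first), no leading zero, no two adjacent 1s, value Σ b_i F_i.

zval : List Bool → ℕ
zval [] = 0
zval (b ∷ bs) = (if b then fib (length bs ℕ.+ 2) else 0) ℕ.+ zval bs

NoLeadingZero : List Bool → Set
NoLeadingZero [] = ⊤'
  where open import Data.Unit using () renaming (⊤ to ⊤')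
NoLeadingZero (b ∷ _) = b ≡ true

NotBoth : Bool → Bool → Set
NotBoth a b = ¬ (a ≡ true × b ≡ true)

IsZeckendorf : List Bool → ℕ → Set
IsZeckendorf w n = NoLeadingZero w × Linked NotBoth w × zval w ≡ n

ZeckU : List Bool → Set
ZeckU w = Σ ℕ λ n → InU n × IsZeckendorf w n

record DFA : Set where
  field
    #states : ℕ
    start   : Fin #states
    δ       : Fin #states → Bool → Fin #states
    final   : Fin #states → Bool

run : (D : DFA) → Fin (DFA.#states D) → List Bool → Fin (DFA.#states D)
run D q [] = q
run D q (b ∷ bs) = run D (DFA.δ D q b) bs

Accepts : DFA → List Bool → Set
Accepts D w = DFA.final D (run D (DFA.start D) w) ≡ true

{-# OPTIONS --safe #-}
module Submission where

-- In ℤ[φ] one has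
-- φ^e = F_{e-1} + F_e φ with F_{-m} = (-1)^{m+1} F_m, so for a natural number n the
-- φ-coordinate Σ F_e vanishes. When exactly one exponent o is odd, this balances a sum of
-- even-indexed Fibonacci numbers plus F_{|o|} against another such sum; comparing
-- Zeckendorf representations forces o = 1, the negative exponents to be -2 together with
-- the negatives of the positive ones, and hence (pairing φ^{2t} + φ^{-2t} = L_{2t} and
-- φ + φ^{-2} = 2) n = 2 + Σ L_{2t}. Conversely every such sum has this representation, and
-- φ-representations are unique (shift all exponents above 1 and compare Zeckendorf sums),
-- which pins down the odd exponent of every representation of n. For regularity, an
-- automaton reads a Zeckendorf word from the most significant digit, guesses the Lucas
-- indices, and checks the digits of F_3 + Σ (F_{2t+1} + F_{2t-1}) against the input with a
-- carry that stays in {-1, 0, 1}; the subset construction makes it deterministic.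

open import Defs
open import Data.Bool using (Bool; true; false; not; _∧_; if_then_else_; T)
open import Data.Bool.Properties using (T?; T-≡; T-∧; not-involutive) renaming (_≟_ to _≟ᵇ_)
open import Data.Empty using (⊥; ⊥-elim)
open import Data.Fin using (Fin; combine; remQuot)
open import Data.Fin.Base using (finToFun; funToFin)
open import Data.Fin.Patterns using (0F; 1F; 2F; 3F)
open import Data.Fin.Properties using (any?; remQuot-combine; finToFun-funToFin; 2↔Bool) renaming (_≟_ to _≟ᶠ_)
open import Data.Integer as ℤ using (ℤ; +_; -[1+_])
import Data.Integer.Properties as ℤ
import Data.Integer.Tactic.RingSolver as ℤ-Solver
open import Data.List using (List; []; _∷_; map; _++_; filter; length; lookup; concatMap; cartesianProduct; allFin)
open import Data.List.Properties using (map-cong; map-id; map-∘; map-++; filter-++; length-++; map-injective)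
open import Data.List.Membership.Propositional using (_∈_; _∉_; find; lose)
open import Data.List.Membership.Propositional.Properties
  using (∈-++⁺ˡ; ∈-++⁺ʳ; ∈-++⁻; ∈-filter⁺; ∈-filter⁻; ∈-map⁺; ∈-concatMap⁺; ∈-concatMap⁻; ∈-cartesianProduct⁺; ∈-allFin)
open import Data.List.Relation.Unary.All as All using (All; []; _∷_)
import Data.List.Relation.Unary.All.Properties as All
open import Data.List.Relation.Unary.AllPairs as AllPairs using (AllPairs; []; _∷_)
import Data.List.Relation.Unary.AllPairs.Properties as AllPairsₚ
open import Data.List.Relation.Unary.Any using (here; there; index)
open import Data.List.Relation.Unary.Any.Properties using (lookup-index)
open import Data.List.Relation.Unary.Linked as Linked using (Linked; []; [-]; _∷_)
open import Data.List.Relation.Unary.Linked.Properties using (Linked⇒AllPairs; AllPairs⇒Linked)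
open import Data.List.Relation.Unary.Unique.Propositional using (Unique)
open import Data.Maybe using (Maybe; just; nothing; maybe)
open import Data.Nat
open import Data.Nat.ListAction using (sum)
open import Data.Nat.ListAction.Properties using (sum-++)
open import Data.Nat.Properties
import Data.Nat.Tactic.RingSolver as ℕ-Solver
open import Data.List.Membership.DecPropositional _≟_ using (_∈?_)
open import Data.Product using (Σ; ∃; _×_; _,_; proj₁; proj₂)
open import Data.Product.Properties using (≡-dec)
open import Data.Sum using (_⊎_; inj₁; inj₂; [_,_]′)
open import Data.Unit using (tt)
open import Function using (_∘_)
open import Function.Bundles using (_⇔_; mk⇔; Equivalence; Inverse)
open import Function.Construct.Composition using (_⇔-∘_)
open import Relation.Binary.Definitions using (DecidableEquality; tri<; tri≈; tri>)
open import Relation.Binary.PropositionalEquality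
open import Relation.Nullary using (¬_)
open import Relation.Nullary.Decidable using (Dec; does; toWitness; fromWitness; isYes≗does; dec-true; dec-false)

open Equivalence using (to; from)

fib-pos : ∀ n → 0 < fib (suc n)
fib-pos zero = s≤s z≤n
fib-pos (suc n) = ≤-trans (fib-pos n) (m≤m+n _ _)

fib-≤-suc : ∀ n → fib n ≤ fib (suc n)
fib-≤-suc zero = z≤n
fib-≤-suc (suc zero) = ≤-refl
fib-≤-suc (suc (suc n)) = m≤m+n _ _

fib-mono : ∀ {m n} → m ≤ n → fib m ≤ fib n
fib-mono {n = zero} z≤n = ≤-refl
fib-mono {m} {suc n} m≤1+n with m≤n⇒m<n∨m≡n m≤1+n
... | inj₁ m<1+n = ≤-trans (fib-mono (s≤s⁻¹ m<1+n)) (fib-≤-suc n)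
... | inj₂ refl = ≤-refl

fib-<⇒< : ∀ {m n} → fib m < fib n → m < n
fib-<⇒< fm<fn = ≰⇒> (λ n≤m → <⇒≱ fm<fn (fib-mono n≤m))

fib-double : ∀ k → fib k + fib k ≤ fib (suc (suc k))
fib-double k = subst (fib k + fib k ≤_) (+-comm (fib k) (fib (suc k))) (+-monoʳ-≤ (fib k) (fib-≤-suc k))

lucas-fib : ∀ n → lucas (suc n) ≡ fib n + fib (suc (suc n))
lucas-fib zero = refl
lucas-fib (suc zero) = refl
lucas-fib (suc (suc n)) = begin
  lucas (suc (suc n)) + lucas (suc n)                  ≡⟨ cong₂ _+_ (lucas-fib (suc n)) (lucas-fib n) ⟩
  (fib (suc n) + fib (3 + n)) + (fib n + fib (2 + n))  ≡⟨ regroup (fib n) (fib (suc n)) ⟩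
  (fib (suc n) + fib n) + (fib (3 + n) + fib (2 + n))  ∎
  where
  open ≡-Reasoning
  regroup : ∀ a b → (b + ((b + a) + b)) + (a + (b + a)) ≡ (b + a) + (((b + a) + b) + (b + a))
  regroup = ℕ-Solver.solve-∀

fib≤lucas : ∀ m → fib (suc (suc m)) ≤ lucas (suc m)
fib≤lucas m = subst (fib (suc (suc m)) ≤_) (sym (lucas-fib m)) (m≤n+m _ (fib m))

even : ℕ → Bool
even zero = true
even (suc n) = not (even n)

odd : ℕ → Bool
odd n = not (even n)

Even Odd : ℕ → Set
Even n = T (even n)
Odd n = T (odd n)

Even⇒≢1 : ∀ {n} → Even n → n ≢ 1
Even⇒≢1 e refl = e

Even⇒¬Odd : ∀ n → Even n → ¬ Odd n
Even⇒¬Odd n e o with even n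
... | true = o
... | false = e

Even⇒¬Even-suc : ∀ n → Even n → ¬ Even (suc n)
Even⇒¬Even-suc n e e′ with even n
... | true = e′
... | false = e

Even-2+ : ∀ n → Even n → Even (2 + n)
Even-2+ n e rewrite not-involutive (even n) = e

Even-2* : ∀ k → Even (2 * k)
Even-2* zero = tt
Even-2* (suc k) = subst Even (sym (*-suc 2 k)) (Even-2+ (2 * k) (Even-2* k))

Even⇒2* : ∀ k → Even k → Σ ℕ λ i → k ≡ 2 * i
Even⇒2* zero _ = 0 , refl
Even⇒2* (suc (suc k)) e with Even⇒2* k (subst T (not-involutive (even k)) e)
... | i , refl = suc i , sym (*-suc 2 i)

All-Even⇒map-2* : ∀ {ks} → All Even ks → Σ (List ℕ) λ is → ks ≡ map (2 *_) is
All-Even⇒map-2* [] = [] , refl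
All-Even⇒map-2* {k ∷ _} (e ∷ es) with Even⇒2* k e | All-Even⇒map-2* es
... | i , refl | is , refl = i ∷ is , refl

oddℤ-+ : ∀ n → oddℤ (+ n) ≡ odd n
oddℤ-+ zero = refl
oddℤ-+ (suc zero) = refl
oddℤ-+ (suc (suc n)) = trans (oddℤ-+ n) (sym (not-involutive (odd n)))

squeeze : ∀ {x y} → x ≤ y → y ≤ suc x → y ≡ x ⊎ y ≡ suc x
squeeze x≤y y≤1+x with m≤n⇒m<n∨m≡n y≤1+x
... | inj₁ y<1+x = inj₁ (≤-antisym (s≤s⁻¹ y<1+x) x≤y)
... | inj₂ y≡1+x = inj₂ y≡1+x

Even-squeeze : ∀ {x y} → Even x → Even y → x ≤ y → y ≤ suc x → y ≡ x
Even-squeeze {x} ex ey x≤y y≤1+x with squeeze x≤y y≤1+x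
... | inj₁ y≡x = y≡x
... | inj₂ refl = ⊥-elim (Even⇒¬Even-suc x ex ey)

Odd-Even-squeeze : ∀ {x y} → Odd x → Even y → x ≤ y → y ≤ suc x → y ≡ suc x
Odd-Even-squeeze {x} ox ey x≤y y≤1+x with squeeze x≤y y≤1+x
... | inj₁ refl = ⊥-elim (Even⇒¬Odd x ey ox)
... | inj₂ y≡1+x = y≡1+x

_≫_ : ℕ → ℕ → Set
i ≫ j = 2 + j ≤ i

Gapped : List ℕ → Set
Gapped = AllPairs _≫_

fibSum : List ℕ → ℕ
fibSum ks = sum (map fib ks)

≫-irrefl : ∀ {x} → ¬ x ≫ x
≫-irrefl {x} x≫x = 1+n≰n (≤-trans (n≤1+n (suc x)) x≫x)

Gapped-related : ∀ {xs x y} → Gapped xs → x ∈ xs → y ∈ xs → x ≡ y ⊎ x ≫ y ⊎ y ≫ x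
Gapped-related (_ ∷ _) (here refl) (here refl) = inj₁ refl
Gapped-related (x≫ ∷ _) (here refl) (there y∈) = inj₂ (inj₁ (All.lookup x≫ y∈))
Gapped-related (y≫ ∷ _) (there x∈) (here refl) = inj₂ (inj₂ (All.lookup y≫ x∈))
Gapped-related (_ ∷ gapped) (there x∈) (there y∈) = Gapped-related gapped x∈ y∈

Gapped-¬adjacent : ∀ {xs x} → Gapped xs → x ∈ xs → suc x ∈ xs → ⊥
Gapped-¬adjacent {x = x} gapped x∈ 1+x∈ with Gapped-related gapped x∈ 1+x∈
... | inj₁ x≡1+x = 1+n≢n (sym x≡1+x)
... | inj₂ (inj₁ x≫1+x) = 1+n≰n (≤-trans (m≤n+m _ 2) x≫1+x)
... | inj₂ (inj₂ 1+x≫x) = 1+n≰n (s≤s⁻¹ 1+x≫x)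

fibSum-≥ : ∀ k ks → fib k ≤ fibSum (k ∷ ks)
fibSum-≥ k ks = m≤m+n (fib k) (fibSum ks)

-- Only index 1 breaks the bound, since fib 1 = fib 2.
fibSum-< : ∀ {k ks} → Gapped (k ∷ ks) → All (_≢ 1) (k ∷ ks) → fibSum (k ∷ ks) < fib (suc k)
fibSum-< {zero} {[]} _ _ = s≤s z≤n
fibSum-< {suc zero} {[]} _ (k≢1 ∷ []) = ⊥-elim (k≢1 refl)
fibSum-< {suc (suc k)} {[]} _ _ = subst (_< fib (3 + k)) (sym (+-identityʳ _)) (m<m+n _ (fib-pos k))
fibSum-< {k} {j ∷ js} ((k≫j ∷ _) ∷ gapped) (_ ∷ ≢1) with k≫j
... | s≤s (s≤s j≤k′) = +-monoʳ-< (fib k) (<-≤-trans (fibSum-< gapped ≢1) (fib-mono (s≤s j≤k′)))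

index-≤ : ∀ {k l s} → fib k ≤ s → s < fib (suc l) → k ≤ l
index-≤ fk≤s s<fl = s≤s⁻¹ (fib-<⇒< (≤-<-trans fk≤s s<fl))

≥2⇒≢1 : ∀ {xs} → All (2 ≤_) xs → All (_≢ 1) xs
≥2⇒≢1 = All.map λ { (s≤s (s≤s _)) () }

fibSum-pos : ∀ {k ks} → All (2 ≤_) (k ∷ ks) → 0 < fibSum (k ∷ ks)
fibSum-pos {suc k} {ks} (_ ∷ _) = ≤-trans (fib-pos k) (fibSum-≥ (suc k) ks)

fibSum-injective : ∀ {ks ls} → Gapped ks → Gapped ls → All (2 ≤_) ks → All (2 ≤_) ls →
                   fibSum ks ≡ fibSum ls → ks ≡ ls
fibSum-injective {[]} {[]} _ _ _ _ _ = refl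
fibSum-injective {[]} {_ ∷ _} _ _ _ ≥2 eq = ⊥-elim (<⇒≢ (fibSum-pos ≥2) eq)
fibSum-injective {_ ∷ _} {[]} _ _ ≥2 _ eq = ⊥-elim (<⇒≢ (fibSum-pos ≥2) (sym eq))
fibSum-injective {k ∷ ks} {l ∷ ls} gk@(_ ∷ gks) gl@(_ ∷ gls) ≥2k@(_ ∷ ≥2ks) ≥2l@(_ ∷ ≥2ls) eq
  with ≤-antisym (index-≤ {k} {l} (subst (fib k ≤_) eq (fibSum-≥ k ks)) (fibSum-< gl (≥2⇒≢1 ≥2l)))
                 (index-≤ {l} {k} (subst (fib l ≤_) (sym eq) (fibSum-≥ l ls)) (fibSum-< gk (≥2⇒≢1 ≥2k)))
... | refl = cong (k ∷_) (fibSum-injective gks gls ≥2ks ≥2ls (+-cancelˡ-≡ (fib k) _ _ eq))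

odd-carry-base : ∀ {bs k s} → Gapped bs → All Even bs → Odd k → s < fib k →
                 s + fib k ≡ fibSum bs → suc k ∈ bs × fib (pred k) ≤ s
odd-carry-base {[]} {suc k} _ _ _ _ eq = ⊥-elim (<⇒≢ (≤-trans (fib-pos k) (m≤n+m _ _)) (sym eq))
odd-carry-base {b ∷ bs} {suc k} {s} gb eb@(eb₀ ∷ _) ok s<fk eq with Odd-Even-squeeze {suc k} {b} ok eb₀ k+1≤b b≤k+2
  where
  k+1≤b : suc k ≤ b
  k+1≤b = index-≤ (m≤n+m (fib (suc k)) s) (subst (_< fib (suc b)) (sym eq) (fibSum-< gb (All.map Even⇒≢1 eb)))
  b≤k+2 : b ≤ suc (suc k)
  b≤k+2 = index-≤ (fibSum-≥ b bs) (subst (_< fib (3 + k)) eq (<-≤-trans (+-monoˡ-< (fib (suc k)) s<fk) (fib-double (suc k))))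
... | refl = here refl , subst (fib k ≤_) (sym s≡) (m≤m+n (fib k) (fibSum bs))
  where
  rotate : ∀ a b c → (a + b) + c ≡ (b + c) + a
  rotate = ℕ-Solver.solve-∀
  s≡ : s ≡ fib k + fibSum bs
  s≡ = +-cancelʳ-≡ (fib (suc k)) s _ (trans eq (rotate (fib (suc k)) (fib k) (fibSum bs)))

odd-carry-step : ∀ {a as b bs k} → Gapped (a ∷ as) → Gapped (b ∷ bs) → All Even (a ∷ as) → All Even (b ∷ bs) →
                 k < a → fibSum (a ∷ as) + fib k ≡ fibSum (b ∷ bs) → a ≡ b
odd-carry-step {a} {as} {b} {bs} {k} ga gb ea@(ea₀ ∷ _) eb@(eb₀ ∷ _) k<a eq =
  sym (Even-squeeze {a} {b} ea₀ eb₀ a≤b b≤a+1)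
  where
  a≤b : a ≤ b
  a≤b = index-≤ (≤-trans (fibSum-≥ a as) (m≤m+n _ (fib k))) (subst (_< fib (suc b)) (sym eq) (fibSum-< gb (All.map Even⇒≢1 eb)))
  b≤a+1 : b ≤ suc a
  b≤a+1 = index-≤ (fibSum-≥ b bs) (subst (_< fib (suc (suc a))) eq
            (+-mono-<-≤ (fibSum-< ga (All.map Even⇒≢1 ea)) (fib-mono (<⇒≤ k<a))))

-- Adding an odd-indexed F_k to a sum of distinct even-indexed Fibonacci numbers can only
-- give another such sum through the carry F_{k-1} + F_k = F_{k+1}.
odd-carry : ∀ {as bs k} → Gapped as → Gapped bs → All Even as → All Even bs → Odd k →
            fibSum as + fib k ≡ fibSum bs → suc k ∈ bs × (2 ≤ k → pred k ∈ as)
odd-carry {[]} {bs} {suc k} _ gb _ eb ok eq with odd-carry-base gb eb ok (fib-pos k) eq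
... | k+1∈bs , fk≤0 = k+1∈bs , λ { (s≤s (s≤s {n = k′} _)) → ⊥-elim (<⇒≱ (fib-pos k′) fk≤0) }
odd-carry {a ∷ as} {bs} {k} ga@(_ ∷ gas) gb ea@(ea₀ ∷ eas) eb ok eq with <-cmp a k
... | tri≈ _ refl _ = ⊥-elim (Even⇒¬Odd a ea₀ ok)
... | tri< a<k _ _ with odd-carry-base gb eb ok (<-≤-trans (fibSum-< ga (All.map Even⇒≢1 ea)) (fib-mono a<k)) eq
...   | k+1∈bs , lower = k+1∈bs , λ _ → here (≤-antisym (index-≤ lower (fibSum-< ga (All.map Even⇒≢1 ea))) (<⇒≤pred a<k))
odd-carry {a ∷ as} {[]} {suc k} _ _ _ _ _ eq | tri> _ _ _ = ⊥-elim (<⇒≢ (≤-trans (fib-pos k) (m≤n+m _ _)) (sym eq))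
odd-carry {a ∷ as} {b ∷ bs} {k} ga@(_ ∷ gas) gb@(_ ∷ gbs) ea@(_ ∷ eas) eb@(_ ∷ ebs) ok eq | tri> _ _ k<a
  with odd-carry-step ga gb ea eb k<a eq
... | refl with odd-carry gas gbs eas ebs ok (+-cancelˡ-≡ (fib a) _ _ (trans (sym (+-assoc (fib a) (fibSum as) (fib k))) eq))
...   | k+1∈bs , pred∈as = there k+1∈bs , λ 2≤k → there (pred∈as 2≤k)

zeroφ : ℤφ
zeroφ = (+ 0) + (+ 0) φ

⊕-identityˡ : ∀ x → zeroφ ⊕ x ≡ x
⊕-identityˡ (a + b φ) = cong₂ _+_φ (ℤ.+-identityˡ a) (ℤ.+-identityˡ b)

⊕-identityʳ : ∀ x → x ⊕ zeroφ ≡ x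
⊕-identityʳ (a + b φ) = cong₂ _+_φ (ℤ.+-identityʳ a) (ℤ.+-identityʳ b)

⊕-comm : ∀ x y → x ⊕ y ≡ y ⊕ x
⊕-comm (a + b φ) (c + d φ) = cong₂ _+_φ (ℤ.+-comm a c) (ℤ.+-comm b d)

⊕-assoc : ∀ x y z → (x ⊕ y) ⊕ z ≡ x ⊕ (y ⊕ z)
⊕-assoc (a + b φ) (c + d φ) (e + f φ) = cong₂ _+_φ (ℤ.+-assoc a c e) (ℤ.+-assoc b d f)

⊕-interchange : ∀ w x y z → (w ⊕ x) ⊕ (y ⊕ z) ≡ (w ⊕ y) ⊕ (x ⊕ z)
⊕-interchange (a + b φ) (c + d φ) (e + f φ) (g + h φ) = cong₂ _+_φ (interchange a c e g) (interchange b d f h)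
  where
  interchange : ∀ a c e g → (a ℤ.+ c) ℤ.+ (e ℤ.+ g) ≡ (a ℤ.+ e) ℤ.+ (c ℤ.+ g)
  interchange = ℤ-Solver.solve-∀

sumφ-++ : ∀ xs ys → sumφ (xs ++ ys) ≡ sumφ xs ⊕ sumφ ys
sumφ-++ [] ys = sym (⊕-identityˡ (sumφ ys))
sumφ-++ (x ∷ xs) ys = trans (cong (φ^ x ⊕_) (sumφ-++ xs ys)) (sym (⊕-assoc (φ^ x) (sumφ xs) (sumφ ys)))

mulφ-divφ : ∀ x → mulφ (divφ x) ≡ x
mulφ-divφ (a + b φ) = cong (a +_φ) (minus-plus b a)
  where
  minus-plus : ∀ b a → (b ℤ.- a) ℤ.+ a ≡ b
  minus-plus = ℤ-Solver.solve-∀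

mulφ-⊕ : ∀ x y → mulφ (x ⊕ y) ≡ mulφ x ⊕ mulφ y
mulφ-⊕ (a + b φ) (c + d φ) = cong ((b ℤ.+ d) +_φ) (interchange a c b d)
  where
  interchange : ∀ a c b d → (a ℤ.+ c) ℤ.+ (b ℤ.+ d) ≡ (a ℤ.+ b) ℤ.+ (c ℤ.+ d)
  interchange = ℤ-Solver.solve-∀

φ^-suc : ∀ e → φ^ (ℤ.suc e) ≡ mulφ (φ^ e)
φ^-suc (+ n) = refl
φ^-suc -[1+ zero ] = refl
φ^-suc -[1+ suc n ] = sym (mulφ-divφ (φ^ -[1+ n ]))

mulφ-sumφ : ∀ es → mulφ (sumφ es) ≡ sumφ (map ℤ.suc es)
mulφ-sumφ [] = refl
mulφ-sumφ (e ∷ es) = begin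
  mulφ (φ^ e ⊕ sumφ es)               ≡⟨ mulφ-⊕ (φ^ e) (sumφ es) ⟩
  mulφ (φ^ e) ⊕ mulφ (sumφ es)        ≡⟨ cong₂ _⊕_ (sym (φ^-suc e)) (mulφ-sumφ es) ⟩
  φ^ (ℤ.suc e) ⊕ sumφ (map ℤ.suc es)  ∎
  where open ≡-Reasoning

shift : ℕ → ℤ → ℤ
shift s e = e ℤ.+ + s

iter-mulφ-sumφ : ∀ s es → iter mulφ s (sumφ es) ≡ sumφ (map (shift s) es)
iter-mulφ-sumφ zero es = cong sumφ (sym (trans (map-cong ℤ.+-identityʳ es) (map-id es)))
iter-mulφ-sumφ (suc s) es = begin
  mulφ (iter mulφ s (sumφ es))         ≡⟨ cong mulφ (iter-mulφ-sumφ s es) ⟩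
  mulφ (sumφ (map (shift s) es))       ≡⟨ mulφ-sumφ (map (shift s) es) ⟩
  sumφ (map ℤ.suc (map (shift s) es))  ≡⟨ cong sumφ (sym (map-∘ es)) ⟩
  sumφ (map (ℤ.suc ∘ shift s) es)      ≡⟨ cong sumφ (map-cong (λ e → suc-shift e (+ s)) es) ⟩
  sumφ (map (shift (suc s)) es)        ∎
  where
  open ≡-Reasoning
  suc-shift : ∀ e t → + 1 ℤ.+ (e ℤ.+ t) ≡ e ℤ.+ (+ 1 ℤ.+ t)
  suc-shift = ℤ-Solver.solve-∀

φ^-+suc : ∀ k → φ^ (+ suc k) ≡ (+ fib k) + (+ fib (suc k)) φ
φ^-+suc zero = refl
φ^-+suc (suc k) = begin
  mulφ (φ^ (+ suc k))                              ≡⟨ cong mulφ (φ^-+suc k) ⟩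
  (+ fib (suc k)) + (+ fib k ℤ.+ + fib (suc k)) φ  ≡⟨ cong ((+ fib (suc k)) +_φ) (sym (ℤ.pos-+ (fib k) (fib (suc k)))) ⟩
  (+ fib (suc k)) + (+ (fib k + fib (suc k))) φ    ≡⟨ cong (λ n → (+ fib (suc k)) + (+ n) φ) (+-comm (fib k) (fib (suc k))) ⟩
  (+ fib (suc k)) + (+ fib (suc (suc k))) φ        ∎
  where open ≡-Reasoning

im-φ^-+ : ∀ k → im (φ^ (+ k)) ≡ + fib k
im-φ^-+ zero = refl
im-φ^-+ (suc k) = cong im (φ^-+suc k)

im-sumφ-+ : ∀ ks → im (sumφ (map +_ ks)) ≡ + fibSum ks
im-sumφ-+ [] = refl
im-sumφ-+ (k ∷ ks) = begin
  im (φ^ (+ k)) ℤ.+ im (sumφ (map +_ ks))  ≡⟨ cong₂ ℤ._+_ (im-φ^-+ k) (im-sumφ-+ ks) ⟩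
  + fib k ℤ.+ + fibSum ks                  ≡⟨ sym (ℤ.pos-+ (fib k) (fibSum ks)) ⟩
  + fibSum (k ∷ ks)                        ∎
  where open ≡-Reasoning

neg : ℕ → ℤ
neg m = ℤ.- (+ m)

φ^-neg-suc : ∀ m → φ^ (neg (suc m)) ≡ divφ (φ^ (neg m))
φ^-neg-suc zero = refl
φ^-neg-suc (suc m) = refl

φ^-neg : ∀ m → φ^ (neg m) ≡ (if even m then (+ fib (suc m)) + (ℤ.- (+ fib m)) φ
                                       else (ℤ.- (+ fib (suc m))) + (+ fib m) φ)
φ^-neg zero = refl
φ^-neg (suc m) = trans (φ^-neg-suc m) (trans (cong divφ (φ^-neg m)) (divφ-alternates (even m)))
  where
  F₀ F₁ F₂ : ℤ
  F₀ = + fib m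
  F₁ = + fib (suc m)
  F₂ = + fib (suc (suc m))
  F₀+F₁ : F₀ ℤ.+ F₁ ≡ F₂
  F₀+F₁ = trans (sym (ℤ.pos-+ (fib m) (fib (suc m)))) (cong +_ (+-comm (fib m) (fib (suc m))))
  minus-neg : ∀ a b → ℤ.- a ℤ.- b ≡ ℤ.- (a ℤ.+ b)
  minus-neg = ℤ-Solver.solve-∀
  minus-minus : ∀ a b → a ℤ.- ℤ.- b ≡ a ℤ.+ b
  minus-minus = ℤ-Solver.solve-∀
  divφ-alternates : ∀ b → divφ (if b then F₁ + (ℤ.- F₀) φ else (ℤ.- F₁) + F₀ φ)
                        ≡ (if not b then F₂ + (ℤ.- F₁) φ else (ℤ.- F₂) + F₁ φ)
  divφ-alternates true = cong (_+ F₁ φ) (trans (minus-neg F₀ F₁) (cong ℤ.-_ F₀+F₁))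
  divφ-alternates false = cong (_+ (ℤ.- F₁) φ) (trans (minus-minus F₀ F₁) F₀+F₁)

im-φ^-neg-even : ∀ {m} → Even m → im (φ^ (neg m)) ≡ ℤ.- (+ fib m)
im-φ^-neg-even {m} e with even m | φ^-neg m
... | true | eq = cong im eq

im-φ^-neg-odd : ∀ {m} → Odd m → im (φ^ (neg m)) ≡ + fib m
im-φ^-neg-odd {m} o with even m | φ^-neg m
... | false | eq = cong im eq

im-sumφ-neg-even : ∀ {ks} → All Even ks → im (sumφ (map neg ks)) ≡ ℤ.- (+ fibSum ks)
im-sumφ-neg-even [] = refl
im-sumφ-neg-even {k ∷ ks} (e ∷ es) = begin
  im (φ^ (neg k)) ℤ.+ im (sumφ (map neg ks))  ≡⟨ cong₂ ℤ._+_ (im-φ^-neg-even {k} e) (im-sumφ-neg-even es) ⟩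
  ℤ.- (+ fib k) ℤ.+ ℤ.- (+ fibSum ks)         ≡⟨ sym (ℤ.neg-distrib-+ (+ fib k) (+ fibSum ks)) ⟩
  ℤ.- (+ fib k ℤ.+ + fibSum ks)               ≡⟨ cong ℤ.-_ (sym (ℤ.pos-+ (fib k) (fibSum ks))) ⟩
  ℤ.- (+ fibSum (k ∷ ks))                     ∎
  where open ≡-Reasoning

im-sumφ-neg-odd : ∀ {ks} → All Odd ks → im (sumφ (map neg ks)) ≡ + fibSum ks
im-sumφ-neg-odd [] = refl
im-sumφ-neg-odd {k ∷ ks} (o ∷ os) =
  trans (cong₂ ℤ._+_ (im-φ^-neg-odd {k} o) (im-sumφ-neg-odd os)) (sym (ℤ.pos-+ (fib k) (fibSum ks)))

φ^-pair : ∀ {p} → Even p → φ^ (+ p) ⊕ φ^ (neg p) ≡ ℕ→ℤφ (lucas p)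
φ^-pair {zero} _ = refl
φ^-pair {suc k} e with even (suc k) | φ^-neg (suc k)
... | true | eq = begin
  φ^ (+ suc k) ⊕ φ^ (neg (suc k))
    ≡⟨ cong₂ _⊕_ (φ^-+suc k) eq ⟩
  (+ fib k ℤ.+ + fib (suc (suc k))) + (+ fib (suc k) ℤ.+ ℤ.- (+ fib (suc k))) φ
    ≡⟨ cong₂ _+_φ (sym (cong +_ (lucas-fib k))) (ℤ.+-inverseʳ (+ fib (suc k))) ⟩
  ℕ→ℤφ (lucas (suc k)) ∎
  where open ≡-Reasoning

sumφ-mirror : ∀ {ks} → All Even ks → sumφ (map +_ ks) ⊕ sumφ (map neg ks) ≡ ℕ→ℤφ (sum (map lucas ks))
sumφ-mirror [] = refl
sumφ-mirror {k ∷ ks} (e ∷ es) = begin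
  (φ^ (+ k) ⊕ sumφ (map +_ ks)) ⊕ (φ^ (neg k) ⊕ sumφ (map neg ks))  ≡⟨ ⊕-interchange (φ^ (+ k)) _ _ _ ⟩
  (φ^ (+ k) ⊕ φ^ (neg k)) ⊕ (sumφ (map +_ ks) ⊕ sumφ (map neg ks))  ≡⟨ cong₂ _⊕_ (φ^-pair {k} e) (sumφ-mirror es) ⟩
  ℕ→ℤφ (lucas k) ⊕ ℕ→ℤφ (sum (map lucas ks))                        ∎
  where open ≡-Reasoning

Gap-trans : ∀ {x y z} → Gap x y → Gap y z → Gap x z
Gap-trans {x} {y} {z} x≥y+2 y≥z+2 = ℤ.≤-trans y≥z+2 (ℤ.≤-trans (ℤ.i≤i+j y (+ 2)) x≥y+2)

Linked-Gap⇒AllPairs : ∀ {es} → Linked Gap es → AllPairs Gap es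
Linked-Gap⇒AllPairs = Linked⇒AllPairs (λ {x} {y} {z} → Gap-trans {x} {y} {z})

Gap-+ : ∀ {a b} → Gap (+ a) (+ b) → a ≫ b
Gap-+ {a} {b} g = subst (_≤ a) (+-comm b 2) (ℤ.drop‿+≤+ g)

Gap-neg : ∀ {x y} → Gap x y → Gap (ℤ.- y) (ℤ.- x)
Gap-neg {x} {y} g = subst₂ ℤ._≤_ (shuffleˡ x y) (shuffleʳ x y) (ℤ.+-monoˡ-≤ (ℤ.- y ℤ.+ ℤ.- x) g)
  where
  shuffleˡ : ∀ x y → y ℤ.+ + 2 ℤ.+ (ℤ.- y ℤ.+ ℤ.- x) ≡ ℤ.- x ℤ.+ + 2
  shuffleˡ = ℤ-Solver.solve-∀
  shuffleʳ : ∀ x y → x ℤ.+ (ℤ.- y ℤ.+ ℤ.- x) ≡ ℤ.- y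
  shuffleʳ = ℤ-Solver.solve-∀

shift-Gap : ∀ s {x y} → Gap x y → Gap (shift s x) (shift s y)
shift-Gap s {x} {y} g = subst (ℤ._≤ shift s x) (swap y (+ s)) (ℤ.+-monoˡ-≤ (+ s) g)
  where
  swap : ∀ y s → y ℤ.+ + 2 ℤ.+ s ≡ y ℤ.+ s ℤ.+ + 2
  swap = ℤ-Solver.solve-∀

shift-injective : ∀ s {x y} → shift s x ≡ shift s y → x ≡ y
shift-injective s {x} {y} eq = trans (unshift x (+ s)) (trans (cong (ℤ._- + s) eq) (sym (unshift y (+ s))))
  where
  unshift : ∀ x s → x ≡ x ℤ.+ s ℤ.- s
  unshift = ℤ-Solver.solve-∀

∈⇒≤sum : ∀ {n ns} → n ∈ ns → n ≤ sum ns
∈⇒≤sum (here refl) = m≤m+n _ _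
∈⇒≤sum {ns = m ∷ _} (there n∈) = ≤-trans (∈⇒≤sum n∈) (m≤n+m _ m)

shift-≥2 : ∀ {e S} → ℤ.∣ e ∣ ≤ S → + 2 ℤ.≤ shift (2 + S) e
shift-≥2 {+ n} {S} _ = ℤ.+≤+ (≤-trans (m≤m+n 2 S) (m≤n+m (2 + S) n))
shift-≥2 { -[1+ n ]} {S} n<S with m≤n⇒∃[o]m+o≡n n<S
... | t , refl = subst (+ 2 ℤ.≤_) (sym (cancel (+ suc n) (+ t))) (ℤ.i≤i+j (+ 2) (+ t))
  where
  cancel : ∀ a t → ℤ.- a ℤ.+ (+ 2 ℤ.+ (a ℤ.+ t)) ≡ + 2 ℤ.+ t
  cancel = ℤ-Solver.solve-∀

lifting-shift : List ℤ → ℕ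
lifting-shift es = 2 + sum (map ℤ.∣_∣ es)

lifting-shift-≥2 : ∀ {e es} → e ∈ es → + 2 ℤ.≤ shift (lifting-shift es) e
lifting-shift-≥2 {e} e∈ = shift-≥2 {e} (∈⇒≤sum (∈-map⁺ ℤ.∣_∣ e∈))

nonnegExps : List ℤ → List ℕ
nonnegExps [] = []
nonnegExps (+ n ∷ es) = n ∷ nonnegExps es
nonnegExps (-[1+ n ] ∷ es) = nonnegExps es

-- Listed in decreasing order, like the exponents themselves.
negMagnitudes : List ℤ → List ℕ
negMagnitudes [] = []
negMagnitudes (+ n ∷ es) = negMagnitudes es
negMagnitudes (-[1+ n ] ∷ es) = negMagnitudes es ++ suc n ∷ []

∈-nonnegExps⁺ : ∀ {es n} → + n ∈ es → n ∈ nonnegExps es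
∈-nonnegExps⁺ {+ _ ∷ _} (here refl) = here refl
∈-nonnegExps⁺ {+ _ ∷ _} (there n∈) = there (∈-nonnegExps⁺ n∈)
∈-nonnegExps⁺ { -[1+ _ ] ∷ _} (there n∈) = ∈-nonnegExps⁺ n∈

∈-nonnegExps⁻ : ∀ {es n} → n ∈ nonnegExps es → + n ∈ es
∈-nonnegExps⁻ {+ _ ∷ _} (here refl) = here refl
∈-nonnegExps⁻ {+ _ ∷ _} (there n∈) = there (∈-nonnegExps⁻ n∈)
∈-nonnegExps⁻ { -[1+ _ ] ∷ _} n∈ = there (∈-nonnegExps⁻ n∈)

∈-negMagnitudes⁺ : ∀ {es n} → -[1+ n ] ∈ es → suc n ∈ negMagnitudes es
∈-negMagnitudes⁺ {+ _ ∷ _} (there n∈) = ∈-negMagnitudes⁺ n∈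
∈-negMagnitudes⁺ { -[1+ _ ] ∷ es} (here refl) = ∈-++⁺ʳ (negMagnitudes es) (here refl)
∈-negMagnitudes⁺ { -[1+ _ ] ∷ _} (there n∈) = ∈-++⁺ˡ (∈-negMagnitudes⁺ n∈)

∈-negMagnitudes⁻ : ∀ {es m} → m ∈ negMagnitudes es → neg m ∈ es
∈-negMagnitudes⁻ {+ _ ∷ _} m∈ = there (∈-negMagnitudes⁻ m∈)
∈-negMagnitudes⁻ { -[1+ _ ] ∷ es} m∈ with ∈-++⁻ (negMagnitudes es) m∈
... | inj₁ m∈′ = there (∈-negMagnitudes⁻ m∈′)
... | inj₂ (here refl) = here refl

negMagnitudes-pos : ∀ es → All (0 <_) (negMagnitudes es)
negMagnitudes-pos [] = []
negMagnitudes-pos (+ n ∷ es) = negMagnitudes-pos es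
negMagnitudes-pos (-[1+ n ] ∷ es) = All.++⁺ (negMagnitudes-pos es) (s≤s z≤n ∷ [])

nonnegExps-gapped : ∀ {es} → AllPairs Gap es → Gapped (nonnegExps es)
nonnegExps-gapped {[]} [] = []
nonnegExps-gapped {+ n ∷ es} (g ∷ gs) =
  All.tabulate (λ m∈ → Gap-+ (All.lookup g (∈-nonnegExps⁻ m∈))) ∷ nonnegExps-gapped gs
nonnegExps-gapped { -[1+ n ] ∷ es} (_ ∷ gs) = nonnegExps-gapped gs

negMagnitudes-gapped : ∀ {es} → AllPairs Gap es → Gapped (negMagnitudes es)
negMagnitudes-gapped {[]} [] = []
negMagnitudes-gapped {+ n ∷ es} (_ ∷ gs) = negMagnitudes-gapped gs
negMagnitudes-gapped { -[1+ n ] ∷ es} (g ∷ gs) =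
  AllPairsₚ.++⁺ (negMagnitudes-gapped gs) ([] ∷ []) (All.tabulate λ {m} m∈ → above m m∈ ∷ [])
  where
  above : ∀ m → m ∈ negMagnitudes es → m ≫ suc n
  above m m∈ = Gap-+ (subst (λ x → Gap x (+ suc n)) (ℤ.neg-involutive (+ m)) (Gap-neg (All.lookup g (∈-negMagnitudes⁻ m∈))))

sumφ-split : ∀ es → sumφ es ≡ sumφ (map +_ (nonnegExps es)) ⊕ sumφ (map neg (negMagnitudes es))
sumφ-split [] = refl
sumφ-split (+ n ∷ es) = trans (cong (φ^ (+ n) ⊕_) (sumφ-split es)) (sym (⊕-assoc (φ^ (+ n)) _ _))
sumφ-split (-[1+ n ] ∷ es) = begin
  φ^ -[1+ n ] ⊕ sumφ es                                          ≡⟨ cong (φ^ -[1+ n ] ⊕_) (sumφ-split es) ⟩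
  φ^ -[1+ n ] ⊕ (P ⊕ N)                                          ≡⟨ ⊕-comm (φ^ -[1+ n ]) (P ⊕ N) ⟩
  (P ⊕ N) ⊕ φ^ -[1+ n ]                                          ≡⟨ ⊕-assoc P N (φ^ -[1+ n ]) ⟩
  P ⊕ (N ⊕ φ^ -[1+ n ])                                          ≡⟨ cong (λ x → P ⊕ (N ⊕ x)) (sym (⊕-identityʳ (φ^ -[1+ n ]))) ⟩
  P ⊕ (N ⊕ sumφ (map neg (suc n ∷ [])))                          ≡⟨ cong (P ⊕_) (sym (sumφ-++ (map neg (negMagnitudes es)) _)) ⟩
  P ⊕ sumφ (map neg (negMagnitudes es) ++ map neg (suc n ∷ []))  ≡⟨ cong (λ xs → P ⊕ sumφ xs) (sym (map-++ neg (negMagnitudes es) _)) ⟩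
  P ⊕ sumφ (map neg (negMagnitudes es ++ suc n ∷ []))            ∎
  where
  open ≡-Reasoning
  P N : ℤφ
  P = sumφ (map +_ (nonnegExps es))
  N = sumφ (map neg (negMagnitudes es))

nonnegExps-≥2 : ∀ {es} → All (+ 2 ℤ.≤_) es → map +_ (nonnegExps es) ≡ es × All (2 ≤_) (nonnegExps es)
nonnegExps-≥2 [] = refl , []
nonnegExps-≥2 {+ n ∷ es} (ℤ.+≤+ 2≤n ∷ ≥2) with nonnegExps-≥2 ≥2
... | es≡ , ≥2′ = cong (+ n ∷_) es≡ , 2≤n ∷ ≥2′

shifted-Zeckendorf : ∀ s {es} → Linked Gap es → All (λ e → + 2 ℤ.≤ shift s e) es →
                     Σ (List ℕ) λ ks → map (shift s) es ≡ map +_ ks × Gapped ks × All (2 ≤_) ks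
shifted-Zeckendorf s {es} linked ≥2 with nonnegExps-≥2 (All.map⁺ ≥2)
... | es≡ , ≥2′ = nonnegExps (map (shift s) es) , sym es≡ , nonnegExps-gapped gapped , ≥2′
  where
  gapped : AllPairs Gap (map (shift s) es)
  gapped = AllPairsₚ.map⁺ (AllPairs.map (λ {x} {y} → shift-Gap s {x} {y}) (Linked-Gap⇒AllPairs linked))

-- Multiplying by φ^s moves every exponent to at least 2, where the φ-coordinate of a sum of
-- powers is the Zeckendorf sum of the exponents.
phiRep-unique : ∀ {es fs} → Linked Gap es → Linked Gap fs → sumφ es ≡ sumφ fs → es ≡ fs
phiRep-unique {es} {fs} les lfs eq
  with shifted-Zeckendorf (lifting-shift (es ++ fs)) les (All.tabulate (lifting-shift-≥2 ∘ ∈-++⁺ˡ))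
     | shifted-Zeckendorf (lifting-shift (es ++ fs)) lfs (All.tabulate (lifting-shift-≥2 ∘ ∈-++⁺ʳ es))
... | ks , es≡ , gks , ≥2ks | ls , fs≡ , gls , ≥2ls =
  map-injective (shift-injective s) (trans es≡ (trans (cong (λ xs → map +_ xs) ks≡ls) (sym fs≡)))
  where
  s : ℕ
  s = lifting-shift (es ++ fs)
  fibSum-≡ : + fibSum ks ≡ + fibSum ls
  fibSum-≡ = begin
    + fibSum ks                   ≡⟨ sym (im-sumφ-+ ks) ⟩
    im (sumφ (map +_ ks))         ≡⟨ cong (im ∘ sumφ) (sym es≡) ⟩
    im (sumφ (map (shift s) es))  ≡⟨ cong im (sym (iter-mulφ-sumφ s es)) ⟩
    im (iter mulφ s (sumφ es))    ≡⟨ cong (im ∘ iter mulφ s) eq ⟩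
    im (iter mulφ s (sumφ fs))    ≡⟨ cong im (iter-mulφ-sumφ s fs) ⟩
    im (sumφ (map (shift s) fs))  ≡⟨ cong (im ∘ sumφ) fs≡ ⟩
    im (sumφ (map +_ ls))         ≡⟨ im-sumφ-+ ls ⟩
    + fibSum ls                   ∎
    where open ≡-Reasoning
  ks≡ls : ks ≡ ls
  ks≡ls = fibSum-injective gks gls ≥2ks ≥2ls (ℤ.+-injective fibSum-≡)

evens odds : List ℕ → List ℕ
evens = filter (T? ∘ even)
odds = filter (T? ∘ odd)

evens-Even : ∀ ks → All Even (evens ks)
evens-Even ks = All.tabulate λ k∈ → proj₂ (∈-filter⁻ (T? ∘ even) {xs = ks} k∈)

odds-Odd : ∀ ks → All Odd (odds ks)
odds-Odd ks = All.tabulate λ k∈ → proj₂ (∈-filter⁻ (T? ∘ odd) {xs = ks} k∈)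

∈-evens⁻ : ∀ {k ks} → k ∈ evens ks → k ∈ ks
∈-evens⁻ {ks = ks} k∈ = proj₁ (∈-filter⁻ (T? ∘ even) {xs = ks} k∈)

∈-odds⁻ : ∀ {k ks} → k ∈ odds ks → k ∈ ks
∈-odds⁻ {ks = ks} k∈ = proj₁ (∈-filter⁻ (T? ∘ odd) {xs = ks} k∈)

sumφ-evens-odds : ∀ (g : ℕ → ℤ) ks → sumφ (map g ks) ≡ sumφ (map g (evens ks)) ⊕ sumφ (map g (odds ks))
sumφ-evens-odds g [] = refl
sumφ-evens-odds g (k ∷ ks) with even k
... | true = trans (cong (φ^ (g k) ⊕_) (sumφ-evens-odds g ks)) (sym (⊕-assoc (φ^ (g k)) _ _))
... | false = begin
  φ^ (g k) ⊕ sumφ (map g ks)  ≡⟨ cong (φ^ (g k) ⊕_) (sumφ-evens-odds g ks) ⟩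
  φ^ (g k) ⊕ (E ⊕ O)          ≡⟨ sym (⊕-assoc (φ^ (g k)) E O) ⟩
  (φ^ (g k) ⊕ E) ⊕ O          ≡⟨ cong (_⊕ O) (⊕-comm (φ^ (g k)) E) ⟩
  (E ⊕ φ^ (g k)) ⊕ O          ≡⟨ ⊕-assoc E (φ^ (g k)) O ⟩
  E ⊕ (φ^ (g k) ⊕ O)          ∎
  where
  open ≡-Reasoning
  E O : ℤφ
  E = sumφ (map g (evens ks))
  O = sumφ (map g (odds ks))

#odds : List ℕ → ℕ
#odds ks = length (odds ks)

bit : Bool → ℕ
bit false = 0
bit true = 1

#odd-∷ : ∀ e es → #odd (e ∷ es) ≡ bit (oddℤ e) + #odd es
#odd-∷ e es with oddℤ e
... | true = refl
... | false = refl

#odd-++ : ∀ xs ys → #odd (xs ++ ys) ≡ #odd xs + #odd ys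
#odd-++ xs ys = trans (cong length (filter-++ (λ i → T? (oddℤ i)) xs ys)) (length-++ (filter (λ i → T? (oddℤ i)) xs))

#odds-∷ : ∀ k ks → #odds (k ∷ ks) ≡ bit (odd k) + #odds ks
#odds-∷ k ks with odd k
... | true = refl
... | false = refl

#odds-++ : ∀ ks ls → #odds (ks ++ ls) ≡ #odds ks + #odds ls
#odds-++ ks ls = trans (cong length (filter-++ (T? ∘ odd) ks ls)) (length-++ (odds ks))

#odd-split : ∀ es → #odd es ≡ #odds (nonnegExps es) + #odds (negMagnitudes es)
#odd-split [] = refl
#odd-split (+ n ∷ es) = begin
  #odd (+ n ∷ es)                    ≡⟨ #odd-∷ (+ n) es ⟩
  bit (oddℤ (+ n)) + #odd es          ≡⟨ cong₂ (λ b c → bit b + c) (oddℤ-+ n) (#odd-split es) ⟩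
  bit (odd n) + (#odds P + #odds N)   ≡⟨ sym (+-assoc (bit (odd n)) (#odds P) (#odds N)) ⟩
  (bit (odd n) + #odds P) + #odds N   ≡⟨ cong (_+ #odds N) (sym (#odds-∷ n P)) ⟩
  #odds (n ∷ P) + #odds N            ∎
  where
  open ≡-Reasoning
  P N : List ℕ
  P = nonnegExps es
  N = negMagnitudes es
#odd-split (-[1+ n ] ∷ es) = begin
  #odd (-[1+ n ] ∷ es)                          ≡⟨ #odd-∷ -[1+ n ] es ⟩
  bit (oddℤ -[1+ n ]) + #odd es                ≡⟨ cong₂ (λ b c → bit b + c) (oddℤ-+ (suc n)) (#odd-split es) ⟩
  bit (odd (suc n)) + (#odds P + #odds N)        ≡⟨ rotate (bit (odd (suc n))) (#odds P) (#odds N) ⟩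
  #odds P + (#odds N + (bit (odd (suc n)) + 0))  ≡⟨ cong (λ x → #odds P + (#odds N + x)) (sym (#odds-∷ (suc n) [])) ⟩
  #odds P + (#odds N + #odds (suc n ∷ []))      ≡⟨ cong (_+_ (#odds P)) (sym (#odds-++ N (suc n ∷ []))) ⟩
  #odds P + #odds (N ++ suc n ∷ [])             ∎
  where
  open ≡-Reasoning
  P N : List ℕ
  P = nonnegExps es
  N = negMagnitudes es
  rotate : ∀ a p q → a + (p + q) ≡ p + (q + (a + 0))
  rotate = ℕ-Solver.solve-∀

-- The φ-coordinate of a natural number is 0, and by φ^-neg a negative exponent -m
-- contributes +F_m for odd m and -F_m for even m.
fib-balance : ∀ {es n} → sumφ es ≡ ℕ→ℤφ n →
              fibSum (evens (nonnegExps es)) + fibSum (odds (nonnegExps es)) + fibSum (odds (negMagnitudes es))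
                ≡ fibSum (evens (negMagnitudes es))
fib-balance {es} eq = ℤ.+-injective (begin
  (+ fE ℤ.+ + fO) ℤ.+ + fON                                ≡⟨ move (+ fE ℤ.+ + fO) (+ fEN) (+ fON) ⟩
  ((+ fE ℤ.+ + fO) ℤ.+ (ℤ.- (+ fEN) ℤ.+ + fON)) ℤ.+ + fEN  ≡⟨ cong (ℤ._+ + fEN) (sym im≡) ⟩
  im (sumφ es) ℤ.+ + fEN                                   ≡⟨ cong (λ x → im x ℤ.+ + fEN) eq ⟩
  + fEN                                                    ∎)
  where
  open ≡-Reasoning
  P N : List ℕ
  P = nonnegExps es
  N = negMagnitudes es
  fE fO fEN fON : ℕ
  fE = fibSum (evens P)
  fO = fibSum (odds P)
  fEN = fibSum (evens N)
  fON = fibSum (odds N)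
  move : ∀ a d c → a ℤ.+ c ≡ (a ℤ.+ (ℤ.- d ℤ.+ c)) ℤ.+ d
  move = ℤ-Solver.solve-∀
  im≡ : im (sumφ es) ≡ (+ fE ℤ.+ + fO) ℤ.+ (ℤ.- (+ fEN) ℤ.+ + fON)
  im≡ = begin
    im (sumφ es)
      ≡⟨ cong im (sumφ-split es) ⟩
    im (sumφ (map +_ P)) ℤ.+ im (sumφ (map neg N))
      ≡⟨ cong₂ (λ x y → im x ℤ.+ im y) (sumφ-evens-odds +_ P) (sumφ-evens-odds neg N) ⟩
    (im (sumφ (map +_ (evens P))) ℤ.+ im (sumφ (map +_ (odds P))))
      ℤ.+ (im (sumφ (map neg (evens N))) ℤ.+ im (sumφ (map neg (odds N))))
      ≡⟨ cong₂ ℤ._+_ (cong₂ ℤ._+_ (im-sumφ-+ (evens P)) (im-sumφ-+ (odds P)))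
                     (cong₂ ℤ._+_ (im-sumφ-neg-even (evens-Even N)) (im-sumφ-neg-odd (odds-Odd N))) ⟩
    (+ fE ℤ.+ + fO) ℤ.+ (ℤ.- (+ fEN) ℤ.+ + fON)
      ∎

-- A negative odd exponent -m, or a positive one o ≥ 3, would by odd-carry force -(m + 1),
-- resp. o - 1, to be an exponent too, against the gaps.
odd-exponents≡[1] : ∀ {es n} → IsPhiRep es n → #odd es ≡ 1 →
                 odds (nonnegExps es) ≡ 1 ∷ [] × odds (negMagnitudes es) ≡ []
odd-exponents≡[1] {es} (linked , value) one-odd = classify (odds P) (odds N) refl refl (trans (sym (#odd-split es)) one-odd)
  where
  P N : List ℕ
  P = nonnegExps es
  N = negMagnitudes es
  gP : Gapped P
  gP = nonnegExps-gapped (Linked-Gap⇒AllPairs linked)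
  gN : Gapped N
  gN = negMagnitudes-gapped (Linked-Gap⇒AllPairs linked)
  carry : ∀ {k} → Odd k → fibSum (evens P) + fib k ≡ fibSum (evens N) → suc k ∈ evens N × (2 ≤ k → pred k ∈ evens P)
  carry = odd-carry (AllPairsₚ.filter⁺ (T? ∘ even) gP) (AllPairsₚ.filter⁺ (T? ∘ even) gN) (evens-Even P) (evens-Even N)
  balance : ∀ {os ns} → odds P ≡ os → odds N ≡ ns → fibSum (evens P) + fibSum os + fibSum ns ≡ fibSum (evens N)
  balance refl refl = fib-balance {es} value
  classify : ∀ os ns → odds P ≡ os → odds N ≡ ns → length os + length ns ≡ 1 → os ≡ 1 ∷ [] × ns ≡ []
  classify [] [] _ _ ()
  classify (_ ∷ _ ∷ _) _ _ _ ()
  classify (_ ∷ os) (_ ∷ ns) _ _ eq = ⊥-elim (1+n≢0 (suc-injective (trans (sym (+-suc (suc (length os)) (length ns))) eq)))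
  classify [] (m ∷ []) oP oN _ = ⊥-elim (Gapped-¬adjacent gN (∈-odds⁻ m∈) (∈-evens⁻ (proj₁ (carry m-odd balance′))))
    where
    m∈ : m ∈ odds N
    m∈ = subst (m ∈_) (sym oN) (here refl)
    m-odd : Odd m
    m-odd = All.lookup (odds-Odd N) m∈
    pad : ∀ e f → e + f ≡ e + 0 + (f + 0)
    pad = ℕ-Solver.solve-∀
    balance′ : fibSum (evens P) + fib m ≡ fibSum (evens N)
    balance′ = trans (pad (fibSum (evens P)) (fib m)) (balance oP oN)
  classify (zero ∷ []) [] oP _ _ = ⊥-elim (All.lookup (odds-Odd P) (subst (0 ∈_) (sym oP) (here refl)))
  classify (suc zero ∷ []) [] _ _ _ = refl , refl
  classify (suc (suc o) ∷ []) [] oP oN _ =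
    ⊥-elim (Gapped-¬adjacent gP (∈-evens⁻ (proj₂ (carry o-odd balance′) (s≤s (s≤s z≤n)))) (∈-odds⁻ o∈))
    where
    o∈ : suc (suc o) ∈ odds P
    o∈ = subst (suc (suc o) ∈_) (sym oP) (here refl)
    o-odd : Odd (suc (suc o))
    o-odd = All.lookup (odds-Odd P) o∈
    pad : ∀ e f → e + f ≡ e + (f + 0) + 0
    pad = ℕ-Solver.solve-∀
    balance′ : fibSum (evens P) + fib (suc (suc o)) ≡ fibSum (evens N)
    balance′ = trans (pad (fibSum (evens P)) (fib (suc (suc o)))) (balance oP oN)

lucasExponents : List ℤ → List ℕ
lucasExponents es = evens (nonnegExps es)

module _ {es n} (rep : IsPhiRep es n) (one-odd : #odd es ≡ 1) where

  private
    P N : List ℕ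
    P = nonnegExps es
    N = negMagnitudes es
    gP : Gapped P
    gP = nonnegExps-gapped (Linked-Gap⇒AllPairs (proj₁ rep))
    gN : Gapped N
    gN = negMagnitudes-gapped (Linked-Gap⇒AllPairs (proj₁ rep))
    oddP≡ : odds P ≡ 1 ∷ []
    oddP≡ = proj₁ (odd-exponents≡[1] rep one-odd)
    oddN≡ : odds N ≡ []
    oddN≡ = proj₂ (odd-exponents≡[1] rep one-odd)

  odd-exponent-is-1 : ∀ e → e ∈ es → T (oddℤ e) → e ≡ + 1
  odd-exponent-is-1 (+ k) e∈ odd-e with subst (k ∈_) oddP≡ (∈-filter⁺ (T? ∘ odd) (∈-nonnegExps⁺ e∈) (subst T (oddℤ-+ k) odd-e))
  ... | here refl = refl
  odd-exponent-is-1 -[1+ k ] e∈ odd-e with subst (suc k ∈_) oddN≡ (∈-filter⁺ (T? ∘ odd) (∈-negMagnitudes⁺ e∈) (subst T (oddℤ-+ (suc k)) odd-e))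
  ... | ()

  lucasExponents-gapped : Gapped (lucasExponents es)
  lucasExponents-gapped = AllPairsₚ.filter⁺ (T? ∘ even) gP

  lucasExponents-≫2 : All (_≫ 2) (lucasExponents es)
  lucasExponents-≫2 = All.tabulate above
    where
    1∈P : 1 ∈ P
    1∈P = ∈-odds⁻ (subst (1 ∈_) (sym oddP≡) (here refl))
    above : ∀ {a} → a ∈ evens P → a ≫ 2
    above a∈ with ∈-filter⁻ (T? ∘ even) {xs = P} a∈
    ... | a∈P , even-a with Gapped-related gP a∈P 1∈P
    ...   | inj₁ refl = ⊥-elim even-a
    ...   | inj₂ (inj₂ (s≤s ()))
    ...   | inj₂ (inj₁ 3≤a) with m≤n⇒m<n∨m≡n 3≤a
    ...     | inj₁ 3<a = 3<a
    ...     | inj₂ refl = ⊥-elim even-a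

  negMagnitudes-evens : evens N ≡ lucasExponents es ++ 2 ∷ []
  negMagnitudes-evens = sym (fibSum-injective gapped-E2 (AllPairsₚ.filter⁺ (T? ∘ even) gN) ≥2-E2 ≥2-N fibSum-≡)
    where
    E : List ℕ
    E = lucasExponents es
    gapped-E2 : Gapped (E ++ 2 ∷ [])
    gapped-E2 = AllPairsₚ.++⁺ lucasExponents-gapped ([] ∷ []) (All.map (_∷ []) lucasExponents-≫2)
    ≥2-E2 : All (2 ≤_) (E ++ 2 ∷ [])
    ≥2-E2 = All.++⁺ (All.map (≤-trans (m≤n+m 2 2)) lucasExponents-≫2) (≤-refl ∷ [])
    ≥2 : ∀ {m} → 0 < m → Even m → 2 ≤ m
    ≥2 {suc zero} _ ()
    ≥2 {suc (suc m)} _ _ = s≤s (s≤s z≤n)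
    ≥2-N : All (2 ≤_) (evens N)
    ≥2-N = All.tabulate λ m∈ → ≥2 (All.lookup (negMagnitudes-pos es) (∈-evens⁻ m∈)) (All.lookup (evens-Even N) m∈)
    fibSum-≡ : fibSum (E ++ 2 ∷ []) ≡ fibSum (evens N)
    fibSum-≡ = begin
      fibSum (E ++ 2 ∷ [])                            ≡⟨ cong sum (map-++ fib E (2 ∷ [])) ⟩
      sum (map fib E ++ 1 ∷ [])                       ≡⟨ sum-++ (map fib E) (1 ∷ []) ⟩
      fibSum E + fibSum (1 ∷ [])                      ≡⟨ sym (+-identityʳ _) ⟩
      fibSum E + fibSum (1 ∷ []) + fibSum []          ≡⟨ cong₂ (λ os ns → fibSum E + fibSum os + fibSum ns) (sym oddP≡) (sym oddN≡) ⟩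
      fibSum E + fibSum (odds P) + fibSum (odds N)    ≡⟨ fib-balance {es} (proj₂ rep) ⟩
      fibSum (evens N)                                ∎
      where open ≡-Reasoning

  lucasExponents-value : n ≡ 2 + sum (map lucas (lucasExponents es))
  lucasExponents-value = trans (ℤ.+-injective (cong re (trans (sym (proj₂ rep)) sumφ≡))) (+-comm (sum (map lucas E)) 2)
    where
    E : List ℕ
    E = lucasExponents es
    X Y φ¹ : ℤφ
    X = sumφ (map +_ E)
    Y = sumφ (map neg E)
    φ¹ = sumφ (+ 1 ∷ [])
    sumφ≡ : sumφ es ≡ ℕ→ℤφ (sum (map lucas E) + 2)
    sumφ≡ = begin
      sumφ es
        ≡⟨ sumφ-split es ⟩
      sumφ (map +_ P) ⊕ sumφ (map neg N)
        ≡⟨ cong₂ _⊕_ (sumφ-evens-odds +_ P) (sumφ-evens-odds neg N) ⟩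
      (X ⊕ sumφ (map +_ (odds P))) ⊕ (sumφ (map neg (evens N)) ⊕ sumφ (map neg (odds N)))
        ≡⟨ cong₂ (λ os ns → (X ⊕ sumφ (map +_ os)) ⊕ (sumφ (map neg (evens N)) ⊕ sumφ (map neg ns))) oddP≡ oddN≡ ⟩
      (X ⊕ φ¹) ⊕ (sumφ (map neg (evens N)) ⊕ zeroφ)
        ≡⟨ cong ((X ⊕ φ¹) ⊕_) (⊕-identityʳ _) ⟩
      (X ⊕ φ¹) ⊕ sumφ (map neg (evens N))
        ≡⟨ cong (λ ks → (X ⊕ φ¹) ⊕ sumφ (map neg ks)) negMagnitudes-evens ⟩
      (X ⊕ φ¹) ⊕ sumφ (map neg (E ++ 2 ∷ []))
        ≡⟨ cong (λ xs → (X ⊕ φ¹) ⊕ sumφ xs) (map-++ neg E (2 ∷ [])) ⟩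
      (X ⊕ φ¹) ⊕ sumφ (map neg E ++ neg 2 ∷ [])
        ≡⟨ cong ((X ⊕ φ¹) ⊕_) (sumφ-++ (map neg E) (neg 2 ∷ [])) ⟩
      (X ⊕ φ¹) ⊕ (Y ⊕ sumφ (neg 2 ∷ []))
        ≡⟨ ⊕-interchange X φ¹ Y _ ⟩
      (X ⊕ Y) ⊕ (φ¹ ⊕ sumφ (neg 2 ∷ []))
        ≡⟨ cong (_⊕ ℕ→ℤφ 2) (sumφ-mirror (evens-Even P)) ⟩
      ℕ→ℤφ (sum (map lucas E) + 2)
        ∎
      where open ≡-Reasoning

-- A bit list b_{K+1} ⋯ b_2, most significant first as in zval, encodes the Lucas indices t with b_t set.
lucasSum : List Bool → ℕ
lucasSum [] = 0
lucasSum (b ∷ bs) = (if b then lucas (2 * (length bs + 2)) else 0) + lucasSum bs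

lucasRep : List Bool → List ℤ
lucasRep [] = + 1 ∷ -[1+ 1 ] ∷ []
lucasRep (false ∷ bs) = lucasRep bs
lucasRep (true ∷ bs) = + (2 * (length bs + 2)) ∷ (lucasRep bs ++ neg (2 * (length bs + 2)) ∷ [])

bound⇒Gap : ∀ {e B} → ℤ.∣ e ∣ ≤ B → Gap (+ (2 + B)) e
bound⇒Gap {+ m} {B} m≤B = ℤ.+≤+ (subst (_≤ 2 + B) (+-comm 2 m) (+-monoʳ-≤ 2 m≤B))
bound⇒Gap { -[1+ m ]} {B} _ = ℤ.≤-trans (ℤ.+-monoˡ-≤ (+ 2) (ℤ.-≤+ {m} {0})) (ℤ.+≤+ (m≤m+n 2 B))

bound⇒Gap-neg : ∀ {e B} → ℤ.∣ e ∣ ≤ B → Gap e (neg (2 + B))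
bound⇒Gap-neg {e} {B} e≤B =
  subst (λ x → Gap x (neg (2 + B))) (ℤ.neg-involutive e)
    (Gap-neg {+ (2 + B)} {ℤ.- e} (bound⇒Gap {ℤ.- e} (subst (_≤ B) (sym (ℤ.∣-i∣≡∣i∣ e)) e≤B)))

2*[L+2] : ∀ L → 2 * (L + 2) ≡ 2 + (2 + 2 * L)
2*[L+2] = ℕ-Solver.solve-∀

lucasRep-bounded : ∀ bs → All (λ e → ℤ.∣ e ∣ ≤ 2 + 2 * length bs) (lucasRep bs)
lucasRep-bounded [] = s≤s z≤n ∷ ≤-refl ∷ []
lucasRep-bounded (false ∷ bs) = All.map (λ le → ≤-trans le (+-monoʳ-≤ 2 (*-monoʳ-≤ 2 (n≤1+n _)))) (lucasRep-bounded bs)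
lucasRep-bounded (true ∷ bs) = outer ∷ All.++⁺ (All.map inner (lucasRep-bounded bs)) (subst (_≤ 2 + 2 * suc L) (sym (ℤ.∣-i∣≡∣i∣ (+ _))) outer ∷ [])
  where
  L : ℕ
  L = length bs
  outer : 2 * (L + 2) ≤ 2 + 2 * suc L
  outer = ≤-reflexive (trans (2*[L+2] L) (cong (_+_ 2) (sym (*-suc 2 L))))
  inner : ∀ {x} → x ≤ 2 + 2 * L → x ≤ 2 + 2 * suc L
  inner le = ≤-trans le (+-monoʳ-≤ 2 (*-monoʳ-≤ 2 (n≤1+n L)))

lucasRep-gapped : ∀ bs → AllPairs Gap (lucasRep bs)
lucasRep-gapped [] = (ℤ.+≤+ z≤n ∷ []) ∷ [] ∷ []
lucasRep-gapped (false ∷ bs) = lucasRep-gapped bs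
lucasRep-gapped (true ∷ bs) =
  All.++⁺ (All.map (λ {e} → outer-Gap {e}) (lucasRep-bounded bs)) (outer-Gap-neg ∷ [])
  ∷ AllPairsₚ.++⁺ (lucasRep-gapped bs) ([] ∷ []) (All.map (λ {e} le → inner-Gap {e} le ∷ []) (lucasRep-bounded bs))
  where
  t : ℕ
  t = 2 * (length bs + 2)
  t≡ : t ≡ 2 + (2 + 2 * length bs)
  t≡ = 2*[L+2] (length bs)
  outer-Gap : ∀ {e} → ℤ.∣ e ∣ ≤ 2 + 2 * length bs → Gap (+ t) e
  outer-Gap {e} le = subst (λ t → Gap (+ t) e) (sym t≡) (bound⇒Gap {e} le)
  inner-Gap : ∀ {e} → ℤ.∣ e ∣ ≤ 2 + 2 * length bs → Gap e (neg t)
  inner-Gap {e} le = subst (λ t → Gap e (neg t)) (sym t≡) (bound⇒Gap-neg {e} le)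
  outer-Gap-neg : Gap (+ t) (neg t)
  outer-Gap-neg = Gap-trans {+ t} {+ 1} {neg t} (outer-Gap {+ 1} (s≤s z≤n)) (inner-Gap {+ 1} (s≤s z≤n))

lucasRep-value : ∀ bs → sumφ (lucasRep bs) ≡ ℕ→ℤφ (2 + lucasSum bs)
lucasRep-value [] = refl
lucasRep-value (false ∷ bs) = lucasRep-value bs
lucasRep-value (true ∷ bs) = begin
  φ^ (+ t) ⊕ sumφ (R ++ neg t ∷ [])              ≡⟨ cong (φ^ (+ t) ⊕_) (sumφ-++ R (neg t ∷ [])) ⟩
  φ^ (+ t) ⊕ (sumφ R ⊕ (φ^ (neg t) ⊕ zeroφ))     ≡⟨ cong (λ x → φ^ (+ t) ⊕ (sumφ R ⊕ x)) (⊕-identityʳ _) ⟩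
  φ^ (+ t) ⊕ (sumφ R ⊕ φ^ (neg t))               ≡⟨ cong (φ^ (+ t) ⊕_) (⊕-comm (sumφ R) (φ^ (neg t))) ⟩
  φ^ (+ t) ⊕ (φ^ (neg t) ⊕ sumφ R)               ≡⟨ sym (⊕-assoc (φ^ (+ t)) (φ^ (neg t)) (sumφ R)) ⟩
  (φ^ (+ t) ⊕ φ^ (neg t)) ⊕ sumφ R               ≡⟨ cong₂ _⊕_ (φ^-pair {t} (Even-2* (length bs + 2))) (lucasRep-value bs) ⟩
  ℕ→ℤφ (lucas t) ⊕ ℕ→ℤφ (2 + lucasSum bs)        ≡⟨ cong ℕ→ℤφ (+-comm (lucas t) (2 + lucasSum bs)) ⟩
  ℕ→ℤφ (2 + (lucasSum bs + lucas t))             ≡⟨ cong (λ x → ℕ→ℤφ (2 + x)) (+-comm (lucasSum bs) (lucas t)) ⟩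
  ℕ→ℤφ (2 + lucasSum (true ∷ bs))                ∎
  where
  open ≡-Reasoning
  t : ℕ
  t = 2 * (length bs + 2)
  R : List ℤ
  R = lucasRep bs

oddℤ-neg : ∀ m → oddℤ (neg m) ≡ odd m
oddℤ-neg m = trans (cong (λ k → (k % 2) ≡ᵇ 1) (ℤ.∣-i∣≡∣i∣ (+ m))) (oddℤ-+ m)

lucasRep-#odd : ∀ bs → #odd (lucasRep bs) ≡ 1
lucasRep-#odd [] = refl
lucasRep-#odd (false ∷ bs) = lucasRep-#odd bs
lucasRep-#odd (true ∷ bs) = begin
  #odd (+ t ∷ (lucasRep bs ++ neg t ∷ []))            ≡⟨ #odd-∷ (+ t) _ ⟩
  bit (oddℤ (+ t)) + #odd (lucasRep bs ++ neg t ∷ [])  ≡⟨ cong₂ _+_ (cong bit (trans (oddℤ-+ t) t-even)) (#odd-++ (lucasRep bs) (neg t ∷ [])) ⟩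
  #odd (lucasRep bs) + #odd (neg t ∷ [])              ≡⟨ cong₂ _+_ (lucasRep-#odd bs) (trans (#odd-∷ (neg t) []) (cong (λ b → bit b + 0) (trans (oddℤ-neg t) t-even))) ⟩
  1                                                   ∎
  where
  open ≡-Reasoning
  t : ℕ
  t = 2 * (length bs + 2)
  t-even : odd t ≡ false
  t-even = cong not (to T-≡ (Even-2* (length bs + 2)))

lucasSum-InU : ∀ bs → InU (2 + lucasSum bs)
lucasSum-InU bs = lucasRep bs , (AllPairs⇒Linked (lucasRep-gapped bs) , lucasRep-value bs) , lucasRep-#odd bs

bitsOf : List ℕ → ℕ → List Bool
bitsOf is zero = []
bitsOf is (suc K) = does (K + 2 ∈? is) ∷ bitsOf is K

length-bitsOf : ∀ is K → length (bitsOf is K) ≡ K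
length-bitsOf is zero = refl
length-bitsOf is (suc K) = cong suc (length-bitsOf is K)

∈?-∷-≢ : ∀ {t i} is → t ≢ i → does (t ∈? i ∷ is) ≡ does (t ∈? is)
∈?-∷-≢ {t} {i} is t≢i rewrite dec-false (t ≟ i) t≢i = refl

lucasSum-bitsOf-[] : ∀ K → lucasSum (bitsOf [] K) ≡ 0
lucasSum-bitsOf-[] zero = refl
lucasSum-bitsOf-[] (suc K) = lucasSum-bitsOf-[] K

bitsOf-above : ∀ {i} is K → K + 2 ≤ i → bitsOf (i ∷ is) K ≡ bitsOf is K
bitsOf-above is zero _ = refl
bitsOf-above is (suc K) K+3≤i =
  cong₂ _∷_ (∈?-∷-≢ is (λ { refl → 1+n≰n K+3≤i })) (bitsOf-above is K (≤-trans (n≤1+n _) K+3≤i))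

lucasSum-bitsOf-∷ : ∀ {i is} K → i ∉ is → 2 ≤ i → i < K + 2 →
                    lucasSum (bitsOf (i ∷ is) K) ≡ lucas (2 * i) + lucasSum (bitsOf is K)
lucasSum-bitsOf-∷ zero _ 2≤i i<2 = ⊥-elim (<⇒≱ i<2 2≤i)
lucasSum-bitsOf-∷ {i} {is} (suc K) i∉ 2≤i i<K+3 with m≤n⇒m<n∨m≡n (s≤s⁻¹ i<K+3)
... | inj₂ refl
  rewrite dec-true (K + 2 ∈? i ∷ is) (here refl) | dec-false (K + 2 ∈? is) i∉
        | bitsOf-above is K (≤-refl {K + 2}) | length-bitsOf is K = refl
... | inj₁ i<K+2 rewrite ∈?-∷-≢ is (λ K+2≡i → <⇒≢ i<K+2 (sym K+2≡i)) | lucasSum-bitsOf-∷ K i∉ 2≤i i<K+2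
                       | length-bitsOf (i ∷ is) K | length-bitsOf is K =
  swap (if does (K + 2 ∈? is) then lucas (2 * (K + 2)) else 0) (lucas (2 * i)) (lucasSum (bitsOf is K))
  where
  swap : ∀ x y z → x + (y + z) ≡ y + (x + z)
  swap = ℕ-Solver.solve-∀

lucasSum-bitsOf : ∀ {is} K → Unique is → All (λ i → 2 ≤ i × i < K + 2) is →
                  lucasSum (bitsOf is K) ≡ sum (map (λ i → lucas (2 * i)) is)
lucasSum-bitsOf {[]} K [] [] = lucasSum-bitsOf-[] K
lucasSum-bitsOf {i ∷ is} K (i≢ ∷ unique) ((2≤i , i<) ∷ bounds) =
  trans (lucasSum-bitsOf-∷ K (All.All¬⇒¬Any i≢) 2≤i i<) (cong (_+_ (lucas (2 * i))) (lucasSum-bitsOf K unique bounds))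

InU⇒lucasIndices : ∀ {n} → InU n →
                   Σ (List ℕ) λ is → Unique is × All (2 ≤_) is × 2 + sum (map (λ i → lucas (2 * i)) is) ≡ n
InU⇒lucasIndices {n} (es , rep , one-odd) with All-Even⇒map-2* (evens-Even (nonnegExps es))
... | is , E≡ = is , unique , ≥2 , sym value
  where
  unique : Unique is
  unique = AllPairs.map (λ { 2i≫2i refl → ≫-irrefl 2i≫2i }) (AllPairsₚ.map⁻ (subst Gapped E≡ (lucasExponents-gapped rep one-odd)))
  ≥2 : All (2 ≤_) is
  ≥2 = All.map (*-cancelˡ-≤ 2) (All.map⁻ (subst (All (_≫ 2)) E≡ (lucasExponents-≫2 rep one-odd)))
  value : n ≡ 2 + sum (map (λ i → lucas (2 * i)) is)
  value = trans (lucasExponents-value rep one-odd)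
                (trans (cong (λ ks → 2 + sum (map lucas ks)) E≡) (cong (λ xs → 2 + sum xs) (sym (map-∘ is))))

lucasIndices⇒InU : ∀ {is} → Unique is → All (2 ≤_) is → InU (2 + sum (map (λ i → lucas (2 * i)) is))
lucasIndices⇒InU {is} unique ≥2 =
  subst (λ s → InU (2 + s)) (lucasSum-bitsOf (sum is) unique bounds) (lucasSum-InU (bitsOf is (sum is)))
  where
  bounds : All (λ i → 2 ≤ i × i < sum is + 2) is
  bounds = All.zipWith (λ (2≤i , i≤) → 2≤i , ≤-trans (s≤s (≤-trans i≤ (m≤m+n (sum is) 1))) (≤-reflexive (sym (+-suc (sum is) 1))))
                       (≥2 , All.tabulate ∈⇒≤sum)

InU-lucasIndices : ∀ n → InU n ⇔ (Σ (List ℕ) λ is → Unique is × All (2 ≤_) is × 2 + sum (map (λ i → lucas (2 * i)) is) ≡ n)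
InU-lucasIndices n = mk⇔ InU⇒lucasIndices (λ (is , unique , ≥2 , value) → subst InU value (lucasIndices⇒InU unique ≥2))

InU-odd-exponent : ∀ n → InU n → (fs : List ℤ) → IsPhiRep fs n → (e : ℤ) → e ∈ fs → T (oddℤ e) → e ≡ + 1
InU-odd-exponent n (es , rep , one-odd) fs rep′ e e∈ =
  odd-exponent-is-1 rep one-odd e (subst (e ∈_) (phiRep-unique (proj₁ rep′) (proj₁ rep) (trans (proj₂ rep′) (sym (proj₂ rep)))) e∈)

_⊗_ : DFA → DFA → DFA
D₁ ⊗ D₂ = record
  { #states = D₁.#states * D₂.#states
  ; start   = combine D₁.start D₂.start
  ; δ       = λ q b → combine (D₁.δ (proj₁ (split q)) b) (D₂.δ (proj₂ (split q)) b)
  ; final   = λ q → D₁.final (proj₁ (split q)) ∧ D₂.final (proj₂ (split q))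
  }
  where
  module D₁ = DFA D₁
  module D₂ = DFA D₂
  split : Fin (D₁.#states * D₂.#states) → Fin D₁.#states × Fin D₂.#states
  split = remQuot D₂.#states

run-⊗ : ∀ D₁ D₂ q₁ q₂ w → run (D₁ ⊗ D₂) (combine q₁ q₂) w ≡ combine (run D₁ q₁ w) (run D₂ q₂ w)
run-⊗ D₁ D₂ q₁ q₂ [] = refl
run-⊗ D₁ D₂ q₁ q₂ (b ∷ w) =
  trans (cong (λ (p₁ , p₂) → run (D₁ ⊗ D₂) (combine (DFA.δ D₁ p₁ b) (DFA.δ D₂ p₂ b)) w) (remQuot-combine {DFA.#states D₁} {DFA.#states D₂} q₁ q₂))
        (run-⊗ D₁ D₂ (DFA.δ D₁ q₁ b) (DFA.δ D₂ q₂ b) w)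

∧-≡-true : ∀ {a b} → a ∧ b ≡ true ⇔ (a ≡ true × b ≡ true)
∧-≡-true {true} = mk⇔ (refl ,_) proj₂
∧-≡-true {false} = mk⇔ (λ ()) (λ ())

Accepts-⊗ : ∀ D₁ D₂ w → Accepts (D₁ ⊗ D₂) w ⇔ (Accepts D₁ w × Accepts D₂ w)
Accepts-⊗ D₁ D₂ w = subst (λ b → b ≡ true ⇔ (Accepts D₁ w × Accepts D₂ w)) (sym final≡) ∧-≡-true
  where
  r₁ : Fin (DFA.#states D₁)
  r₁ = run D₁ (DFA.start D₁) w
  r₂ : Fin (DFA.#states D₂)
  r₂ = run D₂ (DFA.start D₂) w
  final≡ : DFA.final (D₁ ⊗ D₂) (run (D₁ ⊗ D₂) (DFA.start (D₁ ⊗ D₂)) w) ≡ DFA.final D₁ r₁ ∧ DFA.final D₂ r₂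
  final≡ = trans (cong (DFA.final (D₁ ⊗ D₂)) (run-⊗ D₁ D₂ (DFA.start D₁) (DFA.start D₂) w))
                 (cong (λ (p₁ , p₂) → DFA.final D₁ p₁ ∧ DFA.final D₂ p₂) (remQuot-combine {DFA.#states D₁} {DFA.#states D₂} r₁ r₂))

T-does : ∀ {P : Set} (d : Dec P) → T (does d) ⇔ P
T-does d = subst (λ b → T b ⇔ _) (isYes≗does d) (mk⇔ toWitness fromWitness)

record NFA : Set₁ where
  field
    State     : Set
    _≟ₛ_      : DecidableEquality State
    states    : List State
    complete  : ∀ s → s ∈ states
    initial   : List State
    next      : State → Bool → List State
    accepting : State → Bool

module _ (N : NFA) where
  open NFA N

  data Run : State → List Bool → Set where
    accept : ∀ {s} → T (accepting s) → Run s []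
    step   : ∀ {s t b w} → t ∈ next s b → Run t w → Run s (b ∷ w)

  NAccepts : List Bool → Set
  NAccepts w = ∃ λ s → s ∈ initial × Run s w

module Determinise (N : NFA) where
  open NFA N
  open import Data.List.Membership.DecPropositional _≟ₛ_ using () renaming (_∈?_ to _∈ₛ?_)

  k : ℕ
  k = length states

  state : Fin k → State
  state = lookup states

  -- Subsets of the states are functions Fin k → Fin 2, stored in Fin (2 ^ k) by funToFin.
  member : Fin (2 ^ k) → Fin k → Bool
  member x i = Inverse.to 2↔Bool (finToFun x i)

  subset : (Fin k → Bool) → Fin (2 ^ k)
  subset S = funToFin (Inverse.from 2↔Bool ∘ S)

  member-subset : ∀ S i → member (subset S) i ≡ S i
  member-subset S i = trans (cong (Inverse.to 2↔Bool) (finToFun-funToFin (Inverse.from 2↔Bool ∘ S) i))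
                            (Inverse.strictlyInverseˡ 2↔Bool (S i))

  anyᶠ : (Fin k → Bool) → Bool
  anyᶠ f = does (any? (T? ∘ f))

  T-anyᶠ : ∀ f → T (anyᶠ f) ⇔ ∃ λ i → T (f i)
  T-anyᶠ f = T-does (any? (T? ∘ f))

  T-∈? : ∀ {s ss} → T (does (s ∈ₛ? ss)) ⇔ s ∈ ss
  T-∈? {s} {ss} = T-does (s ∈ₛ? ss)

  dfa : DFA
  dfa = record
    { #states = 2 ^ k
    ; start   = subset (λ i → does (state i ∈ₛ? initial))
    ; δ       = λ x b → subset (λ j → anyᶠ (λ i → member x i ∧ does (state j ∈ₛ? next (state i) b)))
    ; final   = λ x → anyᶠ (λ i → member x i ∧ accepting (state i))
    }

  state-index : ∀ s → state (index (complete s)) ≡ s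
  state-index s = sym (lookup-index (complete s))

  accepts-from : ∀ x w → T (DFA.final dfa (run dfa x w)) ⇔ ∃ λ i → T (member x i) × Run N (state i) w
  accepts-from x [] = mk⇔
    (λ fin → let (i , mi∧acc) = to (T-anyᶠ _) fin in i , proj₁ (to T-∧ mi∧acc) , accept (proj₂ (to T-∧ mi∧acc)))
    (λ { (i , mi , accept acc) → from (T-anyᶠ _) (i , from T-∧ (mi , acc)) })
  accepts-from x (b ∷ w) = mk⇔ forward backward
    where
    x′ : Fin (2 ^ k)
    x′ = DFA.δ dfa x b
    forward : T (DFA.final dfa (run dfa x′ w)) → ∃ λ i → T (member x i) × Run N (state i) (b ∷ w)
    forward fin with to (accepts-from x′ w) fin
    ... | j , mj , rest with to (T-anyᶠ _) (subst T (member-subset _ j) mj)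
    ...   | i , mi∧ = i , proj₁ (to T-∧ mi∧) , step (to T-∈? (proj₂ (to T-∧ mi∧))) rest
    backward : (∃ λ i → T (member x i) × Run N (state i) (b ∷ w)) → T (DFA.final dfa (run dfa x′ w))
    backward (i , mi , step {t = t} t∈ rest) = from (accepts-from x′ w) (j , mj , subst (λ s → Run N s w) (sym (state-index t)) rest)
      where
      j : Fin k
      j = index (complete t)
      mj : T (member x′ j)
      mj = subst T (sym (member-subset _ j)) (from (T-anyᶠ _) (i , from T-∧ (mi , from T-∈? (subst (_∈ next (state i) b) (sym (state-index t)) t∈))))

  correct : ∀ w → Accepts dfa w ⇔ NAccepts N w
  correct w = mk⇔ forward backward
    where
    forward : Accepts dfa w → NAccepts N w
    forward acc with to (accepts-from (DFA.start dfa) w) (from T-≡ acc)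
    ... | i , mi , r = state i , to T-∈? (subst T (member-subset _ i) mi) , r
    backward : NAccepts N w → Accepts dfa w
    backward (s , s∈ , r) = to T-≡ (from (accepts-from (DFA.start dfa) w)
      (index (complete s) , subst T (sym (member-subset _ _)) (from T-∈? (subst (_∈ initial) (sym (state-index s)) s∈))
      , subst (λ s → Run N s w) (sym (state-index s)) r))

zeckShape : DFA
zeckShape = record { #states = 4 ; start = 0F ; δ = δ ; final = final }
  where
  δ : Fin 4 → Bool → Fin 4
  δ 0F b = if b then 2F else 3F
  δ 1F b = if b then 2F else 1F
  δ 2F b = if b then 3F else 1F
  δ 3F _ = 3F
  final : Fin 4 → Bool
  final 3F = false
  final _ = true

after : Bool → Fin 4
after false = 1F
after true = 2F

zeckShape-dead : ∀ w → DFA.final zeckShape (run zeckShape 3F w) ≡ false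
zeckShape-dead [] = refl
zeckShape-dead (_ ∷ w) = zeckShape-dead w

Linked-cons⇔ : ∀ {x y ys} → NotBoth x y → Linked NotBoth (y ∷ ys) ⇔ Linked NotBoth (x ∷ y ∷ ys)
Linked-cons⇔ nb = mk⇔ (nb ∷_) Linked.tail

zeckShape-after : ∀ b w → DFA.final zeckShape (run zeckShape (after b) w) ≡ true ⇔ Linked NotBoth (b ∷ w)
zeckShape-after false [] = mk⇔ (λ _ → [-]) (λ _ → refl)
zeckShape-after true [] = mk⇔ (λ _ → [-]) (λ _ → refl)
zeckShape-after false (c ∷ w) =
  Linked-cons⇔ (λ ()) ⇔-∘ subst (λ q → DFA.final zeckShape (run zeckShape q w) ≡ true ⇔ Linked NotBoth (c ∷ w)) (after-δ c) (zeckShape-after c w)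
  where
  after-δ : ∀ c → after c ≡ DFA.δ zeckShape 1F c
  after-δ false = refl
  after-δ true = refl
zeckShape-after true (false ∷ w) = Linked-cons⇔ (λ ()) ⇔-∘ zeckShape-after false w
zeckShape-after true (true ∷ w) = mk⇔ (λ final → ⊥-elim (false≢true (trans (sym (zeckShape-dead w)) final)))
                                      (λ linked → ⊥-elim (Linked.head linked (refl , refl)))
  where
  false≢true : false ≢ true
  false≢true ()

Accepts-zeckShape : ∀ w → Accepts zeckShape w ⇔ (NoLeadingZero w × Linked NotBoth w)
Accepts-zeckShape [] = mk⇔ (λ _ → _ , []) (λ _ → refl)
Accepts-zeckShape (false ∷ w) = mk⇔ (λ final → ⊥-elim (false≢true (trans (sym (zeckShape-dead w)) final))) (λ ())
  where
  false≢true : false ≢ true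
  false≢true ()
Accepts-zeckShape (true ∷ w) = mk⇔ (λ final → refl , to (zeckShape-after true w) final) (λ (_ , linked) → from (zeckShape-after true w) linked)


-- The automaton reads a Zeckendorf word from its most significant digit and guesses the bits
-- p_t of a Lucas index set. The target 2 + Σ p_t L_{2t} = F_3 + Σ p_t (F_{2t+1} + F_{2t-1}) has
-- digit p_t + p_{t+1} at each odd position 2t + 1 (plus 1 at position 3) and 0 at even
-- positions. A state holds the two carries of the comparison, the phase, and the last guess.
Carry : Set
Carry = Fin 3

val : Carry → ℤ
val 0F = -[1+ 0 ]
val 1F = + 0
val 2F = + 1

toCarry : ℤ → Maybe Carry
toCarry -[1+ 0 ] = just 0F
toCarry (+ 0) = just 1F
toCarry (+ 1) = just 2F
toCarry _ = nothing

toCarry-val : ∀ c → toCarry (val c) ≡ just c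
toCarry-val 0F = refl
toCarry-val 1F = refl
toCarry-val 2F = refl

val-toCarry : ∀ x {c} → toCarry x ≡ just c → val c ≡ x
val-toCarry -[1+ 0 ] refl = refl
val-toCarry (+ 0) refl = refl
val-toCarry (+ 1) refl = refl
val-toCarry (+ suc (suc _)) ()
val-toCarry -[1+ suc _ ] ()

Phase : Set
Phase = Fin 4

pattern odd-position = 0F
pattern even-position = 1F
pattern position-2 = 2F
pattern halted = 3F

State : Set
State = Carry × Carry × Phase × Bool

Move : Set
Move = ℕ × Phase × Bool

moves : Phase → Bool → List Move
moves odd-position pp = (bit pp , even-position , false) ∷ (bit pp + 1 , even-position , true) ∷ (bit pp + 1 , position-2 , pp) ∷ []
moves even-position pp = (0 , odd-position , pp) ∷ []
moves position-2 pp = (0 , halted , pp) ∷ []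
moves halted pp = []

newCarry : Carry → Carry → Bool → ℕ → ℤ
newCarry a b w d = val a ℤ.+ val b ℤ.+ + bit w ℤ.- + d

via : Carry → Carry → Bool → Move → List State
via a b w (d , ph , pp) = maybe (λ c → (c , a , ph , pp) ∷ []) [] (toCarry (newCarry a b w d))

successors : State → Bool → List State
successors (a , b , ph , pp) w = concatMap (via a b w) (moves ph pp)

halted? : Phase → Bool
halted? halted = true
halted? _ = false

carryNFA : NFA
carryNFA = record
  { State     = State
  ; _≟ₛ_      = ≡-dec _≟ᶠ_ (≡-dec _≟ᶠ_ (≡-dec _≟ᶠ_ _≟ᵇ_))
  ; states    = cartesianProduct (allFin 3) (cartesianProduct (allFin 3) (cartesianProduct (allFin 4) (true ∷ false ∷ [])))
  ; complete  = λ (a , b , ph , pp) → ∈-cartesianProduct⁺ (∈-allFin a) (∈-cartesianProduct⁺ (∈-allFin b) (∈-cartesianProduct⁺ (∈-allFin ph) (∈-bools pp)))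
  ; initial   = (1F , 1F , odd-position , false) ∷ (1F , 1F , even-position , false) ∷ []
  ; next      = successors
  ; accepting = λ (a , b , ph , _) → halted? ph ∧ does (val a ℤ.+ val b ℤ.≟ + 0)
  }
  where
  ∈-bools : ∀ b → b ∈ true ∷ false ∷ []
  ∈-bools true = here refl
  ∈-bools false = there (here refl)

-- V x y v is the part of the target still to be produced by the rest v of the word when the
-- carries are x and y.
V : ℤ → ℤ → List Bool → ℤ
V x y v = x ℤ.* + fib (2 + length v) ℤ.+ y ℤ.* + fib (1 + length v) ℤ.+ + zval v

V-[] : ∀ x y → V x y [] ≡ x ℤ.+ y
V-[] = unit
  where
  unit : ∀ x y → x ℤ.* + 1 ℤ.+ y ℤ.* + 1 ℤ.+ + 0 ≡ x ℤ.+ y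
  unit = ℤ-Solver.solve-∀

V-step : ∀ x y w d v → V x y (w ∷ v) ≡ V (x ℤ.+ y ℤ.+ + bit w ℤ.- + d) x v ℤ.+ + (d * fib (2 + length v))
V-step x y w d v = begin
  x ℤ.* (+ A ℤ.+ + B) ℤ.+ y ℤ.* + A ℤ.+ + (digit w + zval v)
    ≡⟨ cong (ℤ._+_ (x ℤ.* (+ A ℤ.+ + B) ℤ.+ y ℤ.* + A)) (digit≡ w) ⟩
  x ℤ.* (+ A ℤ.+ + B) ℤ.+ y ℤ.* + A ℤ.+ (+ bit w ℤ.* + A ℤ.+ + zval v)
    ≡⟨ regroup x y (+ bit w) (+ d) (+ A) (+ B) (+ zval v) ⟩
  V (x ℤ.+ y ℤ.+ + bit w ℤ.- + d) x v ℤ.+ + d ℤ.* + A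
    ≡⟨ cong (ℤ._+_ (V (x ℤ.+ y ℤ.+ + bit w ℤ.- + d) x v)) (sym (ℤ.pos-* d A)) ⟩
  V (x ℤ.+ y ℤ.+ + bit w ℤ.- + d) x v ℤ.+ + (d * A) ∎
  where
  open ≡-Reasoning
  A B : ℕ
  A = fib (2 + length v)
  B = fib (1 + length v)
  digit : Bool → ℕ
  digit w = if w then fib (length v + 2) else 0
  digit≡ : ∀ w → + (digit w + zval v) ≡ + bit w ℤ.* + A ℤ.+ + zval v
  digit≡ true = trans (cong (λ n → + (fib n + zval v)) (+-comm (length v) 2)) (cong (ℤ._+ + zval v) (sym (ℤ.*-identityˡ (+ A))))
  digit≡ false = sym (ℤ.+-identityˡ (+ zval v))
  regroup : ∀ x y W d A B Z → x ℤ.* (A ℤ.+ B) ℤ.+ y ℤ.* A ℤ.+ (W ℤ.* A ℤ.+ Z)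
                             ≡ ((x ℤ.+ y ℤ.+ W ℤ.- d) ℤ.* A ℤ.+ x ℤ.* B ℤ.+ Z) ℤ.+ d ℤ.* A
  regroup = ℤ-Solver.solve-∀

-- target pp ps is the value of the target digits at positions 3 + 2 * length ps, …, 2, when pp
-- is the guessed bit just above those of ps.
target : Bool → List Bool → ℕ
target pp [] = (bit pp + 1) * 2
target pp (p ∷ ps) = (bit pp + bit p) * fib (5 + 2 * length ps) + target p ps

if≡bit* : ∀ p x → (if p then x else 0) ≡ bit p * x
if≡bit* false x = refl
if≡bit* true x = sym (+-identityʳ x)

target-lucasSum : ∀ pp ps → target pp ps ≡ bit pp * fib (3 + 2 * length ps) + (2 + lucasSum ps)
target-lucasSum pp [] = last-digit (bit pp)
  where
  last-digit : ∀ b → (b + 1) * 2 ≡ b * 2 + (2 + 0)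
  last-digit = ℕ-Solver.solve-∀
target-lucasSum pp (p ∷ ps) = begin
  (bit pp + bit p) * F₅ + target p ps                           ≡⟨ cong (_+_ ((bit pp + bit p) * F₅)) (target-lucasSum p ps) ⟩
  (bit pp + bit p) * F₅ + (bit p * F₃ + (2 + lucasSum ps))      ≡⟨ regroup (bit pp) (bit p) F₃ F₅ (lucasSum ps) ⟩
  bit pp * F₅ + (2 + (bit p * (F₃ + F₅) + lucasSum ps))         ≡⟨ cong₂ (λ x y → bit pp * fib x + (2 + (y + lucasSum ps))) F₅≡ (sym L≡) ⟩
  bit pp * fib (3 + 2 * length (p ∷ ps)) + (2 + lucasSum (p ∷ ps)) ∎
  where
  open ≡-Reasoning
  F₃ F₅ : ℕ
  F₃ = fib (3 + 2 * length ps)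
  F₅ = fib (5 + 2 * length ps)
  F₅≡ : 5 + 2 * length ps ≡ 3 + 2 * suc (length ps)
  F₅≡ = cong (_+_ 3) (sym (*-suc 2 (length ps)))
  double : ∀ L → 2 * (L + 2) ≡ suc (3 + 2 * L)
  double = ℕ-Solver.solve-∀
  index≡ : 2 * (length ps + 2) ≡ suc (3 + 2 * length ps)
  index≡ = double (length ps)
  L≡ : (if p then lucas (2 * (length ps + 2)) else 0) ≡ bit p * (F₃ + F₅)
  L≡ = trans (if≡bit* p _) (cong (λ n → bit p * n) (trans (cong lucas index≡) (lucas-fib (3 + 2 * length ps))))
  regroup : ∀ a b x y s → (a + b) * y + (b * x + (2 + s)) ≡ a * y + (2 + (b * (x + y) + s))
  regroup = ℕ-Solver.solve-∀

target-bound : ∀ pp ps → target pp ps + 2 ≤ 2 * fib (4 + 2 * length ps)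
target-bound false [] = s≤s (s≤s (s≤s (s≤s z≤n)))
target-bound true [] = ≤-refl
target-bound pp (p ∷ ps) = begin
  (bit pp + bit p) * F₅ + target p ps + 2    ≡⟨ +-assoc ((bit pp + bit p) * F₅) (target p ps) 2 ⟩
  (bit pp + bit p) * F₅ + (target p ps + 2)  ≤⟨ +-mono-≤ (*-monoˡ-≤ F₅ (bits≤2 pp p)) (target-bound p ps) ⟩
  2 * F₅ + 2 * F₄                            ≡⟨ sym (*-distribˡ-+ 2 F₅ F₄) ⟩
  2 * fib (6 + 2 * length ps)                ≡⟨ cong (λ n → 2 * fib (4 + n)) (sym (*-suc 2 (length ps))) ⟩
  2 * fib (4 + 2 * length (p ∷ ps))          ∎
  where
  open ≤-Reasoning
  F₅ F₄ : ℕ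
  F₅ = fib (5 + 2 * length ps)
  F₄ = fib (4 + 2 * length ps)
  bits≤2 : ∀ a b → bit a + bit b ≤ 2
  bits≤2 false false = z≤n
  bits≤2 false true = s≤s z≤n
  bits≤2 true false = s≤s z≤n
  bits≤2 true true = ≤-refl

Goal : Phase → Bool → ℤ → ℕ → Set
Goal odd-position pp x m = Σ (List Bool) λ ps → m ≡ 2 + 2 * length ps × x ≡ + target pp ps
Goal even-position pp x m = Σ (List Bool) λ ps → m ≡ 3 + 2 * length ps × x ≡ + target pp ps
Goal position-2 _ x m = m ≡ 1 × x ≡ + 0
Goal halted _ x m = m ≡ 0 × x ≡ + 0

Goal-of : State → List Bool → Set
Goal-of (a , b , ph , pp) v = Goal ph pp (V (val a) (val b) v) (length v)

2+2*suc : ∀ L → 2 + 2 * suc L ≡ suc (3 + 2 * L)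
2+2*suc L = cong (_+_ 2) (*-suc 2 L)

goal-back : ∀ {ph pp d ph′ pp′} → (d , ph′ , pp′) ∈ moves ph pp → ∀ X m →
            Goal ph′ pp′ X m → Goal ph pp (X ℤ.+ + (d * fib (2 + m))) (suc m)
goal-back {odd-position} {pp} (here refl) X m (ps , refl , refl) =
  false ∷ ps , sym (2+2*suc (length ps)) ,
  cong +_ (trans (+-comm (target false ps) _) (cong (λ n → n * fib (5 + 2 * length ps) + target false ps) (sym (+-identityʳ (bit pp)))))
goal-back {odd-position} {pp} (there (here refl)) X m (ps , refl , refl) =
  true ∷ ps , sym (2+2*suc (length ps)) , cong +_ (+-comm (target true ps) _)
goal-back {odd-position} {pp} (there (there (here refl))) X m (refl , refl) = [] , refl , refl
goal-back {even-position} (here refl) X m (ps , refl , refl) = ps , refl , ℤ.+-identityʳ _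
goal-back {position-2} (here refl) X m (refl , refl) = refl , refl
goal-back {halted} () X m

via⁻ : ∀ {a b w d ph pp t} → t ∈ via a b w (d , ph , pp) → Σ Carry λ c → val c ≡ newCarry a b w d × t ≡ (c , a , ph , pp)
via⁻ {a} {b} {w} {d} t∈ with toCarry (newCarry a b w d) in eq
via⁻ {a} {b} {w} {d} (here refl) | just c = c , val-toCarry (newCarry a b w d) eq , refl

sound : ∀ {s v} → Run carryNFA s v → Goal-of s v
sound {a , b , halted , pp} (accept acc) = refl , trans (V-[] (val a) (val b)) (Equivalence.to (T-does (val a ℤ.+ val b ℤ.≟ + 0)) acc)
sound {a , b , ph , pp} {w ∷ v} (step t∈ run) with find (∈-concatMap⁻ (via a b w) {xs = moves ph pp} t∈)
... | (d , ph′ , pp′) , move∈ , t∈via with via⁻ {a} {b} {w} {d} t∈via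
...   | c , c≡ , refl = subst (λ x → Goal ph pp x (suc (length v))) (sym (trans (V-step (val a) (val b) w d v) (cong (λ x → V x (val a) v ℤ.+ _) (sym c≡))))
                          (goal-back move∈ _ (length v) (sound run))

zval-< : ∀ {v} → Linked NotBoth v → zval v < fib (2 + length v)
zval-< {[]} _ = s≤s z≤n
zval-< {false ∷ v} linked = <-≤-trans (zval-< (Linked.tail linked)) (fib-≤-suc (2 + length v))
zval-< {true ∷ []} _ = s≤s (s≤s z≤n)
zval-< {true ∷ true ∷ v} linked = ⊥-elim (Linked.head linked (refl , refl))
zval-< {true ∷ false ∷ v} linked = subst (λ n → fib n + zval v < fib (4 + length v)) (sym (+-comm (suc (length v)) 2))
  (+-monoʳ-< (fib (3 + length v)) (zval-< (Linked.tail (Linked.tail linked))))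

module _ (v : List Bool) {T : ℕ} where
  private
    F F′ z : ℕ
    F = fib (2 + length v)
    F′ = fib (1 + length v)
    z = zval v

  carry-too-high : ∀ k n → V (+ (2 + k)) (+ n) v ≡ + T → T < 2 * F → ⊥
  carry-too-high k n eq T<2F = <⇒≱ T<2F (subst (2 * F ≤_) T≡ (≤-trans (*-monoˡ-≤ F (m≤m+n 2 k)) (≤-trans (m≤m+n _ (n * F′)) (m≤m+n _ z))))
    where
    T≡ : (2 + k) * F + n * F′ + z ≡ T
    T≡ = ℤ.+-injective (trans (cong₂ (λ x y → x ℤ.+ y ℤ.+ + z) (ℤ.pos-* (2 + k) F) (ℤ.pos-* n F′)) eq)

  carry-too-low : ∀ k n → V -[1+ k ] (ℤ.- (+ n)) v ≡ + T → z < F → ⊥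
  carry-too-low k n eq z<F = <⇒≱ z<F (subst (F ≤_) (sym z≡) (≤-trans (m≤m+n F (k * F)) (≤-trans (m≤n+m _ T) (m≤m+n _ (n * F′)))))
    where
    move : ∀ K N A B Z → Z ≡ ((ℤ.- (+ 1 ℤ.+ K)) ℤ.* A ℤ.+ (ℤ.- N) ℤ.* B ℤ.+ Z) ℤ.+ (+ 1 ℤ.+ K) ℤ.* A ℤ.+ N ℤ.* B
    move = ℤ-Solver.solve-∀
    z≡ : z ≡ T + suc k * F + n * F′
    z≡ = ℤ.+-injective (begin
      + z                                                          ≡⟨ move (+ k) (+ n) (+ F) (+ F′) (+ z) ⟩
      V -[1+ k ] (ℤ.- (+ n)) v ℤ.+ + suc k ℤ.* + F ℤ.+ + n ℤ.* + F′ ≡⟨ cong (λ x → x ℤ.+ + suc k ℤ.* + F ℤ.+ + n ℤ.* + F′) eq ⟩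
      + T ℤ.+ + suc k ℤ.* + F ℤ.+ + n ℤ.* + F′                     ≡⟨ cong₂ (λ x y → + T ℤ.+ x ℤ.+ y) (sym (ℤ.pos-* (suc k) F)) (sym (ℤ.pos-* n F′)) ⟩
      + (T + suc k * F + n * F′)                                   ∎)
      where open ≡-Reasoning

  carry-too-low₂ : ∀ k → V -[1+ suc k ] (+ 1) v ≡ + T → z < F → ⊥
  carry-too-low₂ k eq z<F = <⇒≱ (+-mono-<-≤ z<F (fib-≤-suc (1 + length v)))
    (subst (F + F ≤_) (sym z+F′≡) (≤-trans (≤-reflexive (cong (_+_ F) (sym (+-identityʳ F)))) (≤-trans (*-monoˡ-≤ F (m≤m+n 2 k)) (m≤n+m _ T))))
    where
    move : ∀ K A B Z → Z ℤ.+ B ≡ ((ℤ.- (+ 2 ℤ.+ K)) ℤ.* A ℤ.+ + 1 ℤ.* B ℤ.+ Z) ℤ.+ (+ 2 ℤ.+ K) ℤ.* A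
    move = ℤ-Solver.solve-∀
    z+F′≡ : z + F′ ≡ T + (2 + k) * F
    z+F′≡ = ℤ.+-injective (begin
      + z ℤ.+ + F′                                      ≡⟨ move (+ k) (+ F) (+ F′) (+ z) ⟩
      V -[1+ suc k ] (+ 1) v ℤ.+ + (2 + k) ℤ.* + F      ≡⟨ cong₂ ℤ._+_ eq (sym (ℤ.pos-* (2 + k) F)) ⟩
      + (T + (2 + k) * F)                               ∎)
      where open ≡-Reasoning

-- A carry -1 is always preceded by +1; this keeps the next carry below 2 in carry-range.
Inv : Carry → Carry → Set
Inv a b = a ≡ 0F → b ≡ 2F

carry-range : ∀ {a b} w d v {T} → Inv a b → zval v < fib (2 + length v) → T < 2 * fib (2 + length v) →
              V (newCarry a b w d) (val a) v ≡ + T → Σ Carry λ c → val c ≡ newCarry a b w d × Inv c a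
carry-range {a} {b} w d v {T} inv z< T< eq = classify a (newCarry a b w d) refl refl eq
  where
  bit≤1 : ∀ w → bit w ≤ 1
  bit≤1 false = z≤n
  bit≤1 true = ≤-refl
  at-most-1 : ∀ k → newCarry 0F 2F w d ≢ + (2 + k)
  at-most-1 k eq′ = 1+n≰n (≤-trans (≤-trans (m≤m+n 2 (k + d)) (≤-reflexive (sym bit≡))) (bit≤1 w))
    where
    unshift : ∀ W D → W ≡ (W ℤ.- D) ℤ.+ D
    unshift = ℤ-Solver.solve-∀
    bit≡ : bit w ≡ 2 + k + d
    bit≡ = ℤ.+-injective (trans (unshift (+ bit w) (+ d)) (cong (ℤ._+ + d) eq′))
  classify : ∀ a′ x → a′ ≡ a → x ≡ newCarry a b w d → V x (val a′) v ≡ + T → Σ Carry λ c → val c ≡ x × Inv c a′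
  classify _ (+ 0) _ _ _ = 1F , refl , λ ()
  classify _ (+ 1) _ _ _ = 2F , refl , λ ()
  classify 0F (+ suc (suc k)) refl x≡ _ with inv refl
  ... | refl = ⊥-elim (at-most-1 k (sym x≡))
  classify 1F (+ suc (suc k)) _ _ eq = ⊥-elim (carry-too-high v k 0 eq T<)
  classify 2F (+ suc (suc k)) _ _ eq = ⊥-elim (carry-too-high v k 1 eq T<)
  classify 2F -[1+ 0 ] _ _ _ = 0F , refl , λ _ → refl
  classify 2F -[1+ suc k ] _ _ eq = ⊥-elim (carry-too-low₂ v k eq z<)
  classify 0F -[1+ k ] _ _ eq = ⊥-elim (carry-too-low v k 1 eq z<)
  classify 1F -[1+ k ] _ _ eq = ⊥-elim (carry-too-low v k 0 eq z<)

goal-forward : ∀ ph pp Y m → Goal ph pp Y (suc m) →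
               Σ Move λ (d , ph′ , pp′) → (d , ph′ , pp′) ∈ moves ph pp × Σ ℕ λ T →
                 Y ≡ + T ℤ.+ + (d * fib (2 + m)) × Goal ph′ pp′ (+ T) m × T < 2 * fib (2 + m)
goal-forward odd-position pp _ _ ([] , refl , refl) = _ , there (there (here refl)) , 0 , refl , (refl , refl) , s≤s z≤n
goal-forward odd-position pp _ m (p ∷ ps , sm≡ , refl) rewrite suc-injective (trans sm≡ (2+2*suc (length ps))) = guess p
  where
  T< : ∀ p → target p ps < 2 * fib (5 + 2 * length ps)
  T< p = ≤-trans (m<m+n (target p ps) (s≤s z≤n)) (≤-trans (target-bound p ps) (*-monoʳ-≤ 2 (fib-≤-suc (4 + 2 * length ps))))
  guess : ∀ p → Σ Move λ (d , ph′ , pp′) → (d , ph′ , pp′) ∈ moves odd-position pp × Σ ℕ λ T →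
                  + target pp (p ∷ ps) ≡ + T ℤ.+ + (d * fib (5 + 2 * length ps)) × Goal ph′ pp′ (+ T) (3 + 2 * length ps) × T < 2 * fib (5 + 2 * length ps)
  guess false = _ , here refl , target false ps ,
    cong +_ (trans (cong (λ n → n * fib (5 + 2 * length ps) + target false ps) (+-identityʳ (bit pp))) (+-comm _ (target false ps))) ,
    (ps , refl , refl) , T< false
  guess true = _ , there (here refl) , target true ps , cong +_ (+-comm _ (target true ps)) , (ps , refl , refl) , T< true
goal-forward even-position pp _ m (ps , sm≡ , refl) rewrite suc-injective sm≡ =
  _ , here refl , target pp ps , sym (ℤ.+-identityʳ _) , (ps , refl , refl) ,
  ≤-trans (m<m+n (target pp ps) (s≤s z≤n)) (target-bound pp ps)
goal-forward position-2 pp _ _ (refl , refl) = _ , here refl , 0 , refl , (refl , refl) , s≤s z≤n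
goal-forward halted _ _ _ (() , _)

via⁺ : ∀ {a b w d ph pp c} → toCarry (newCarry a b w d) ≡ just c → (c , a , ph , pp) ∈ via a b w (d , ph , pp)
via⁺ eq rewrite eq = here refl

V-next : ∀ a b w d v {T} → V (val a) (val b) (w ∷ v) ≡ + T ℤ.+ + (d * fib (2 + length v)) →
         V (newCarry a b w d) (val a) v ≡ + T
V-next a b w d v eq = cancel (trans (sym (V-step (val a) (val b) w d v)) eq)
  where
  cancel : ∀ {x y e} → x ℤ.+ e ≡ y ℤ.+ e → x ≡ y
  cancel {x} {y} {e} eq = trans (unshift x e) (trans (cong (ℤ._- e) eq) (sym (unshift y e)))
    where
    unshift : ∀ x e → x ≡ x ℤ.+ e ℤ.- e
    unshift = ℤ-Solver.solve-∀

complete : ∀ {a b ph pp} v → Inv a b → Linked NotBoth v → Goal ph pp (V (val a) (val b) v) (length v) → Run carryNFA (a , b , ph , pp) v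
complete {a} {b} {halted} [] _ _ (_ , V≡0) = accept (Equivalence.from (T-does (val a ℤ.+ val b ℤ.≟ + 0)) (trans (sym (V-[] (val a) (val b))) V≡0))
complete {ph = odd-position} [] _ _ (_ , () , _)
complete {ph = even-position} [] _ _ (_ , () , _)
complete {ph = position-2} [] _ _ (() , _)
complete {a} {b} {ph} {pp} (w ∷ v) inv shape goal with goal-forward ph pp _ (length v) goal
... | (d , ph′ , pp′) , move∈ , T , Y≡ , goal′ , T< with carry-range w d v inv (zval-< (Linked.tail shape)) T< (V-next a b w d v Y≡)
...   | c , c≡ , inv′ =
  step (∈-concatMap⁺ (via a b w) (lose move∈ (via⁺ {a} {b} {w} {d} (subst (λ x → toCarry x ≡ just c) c≡ (toCarry-val c)))))
       (complete v inv′ (Linked.tail shape)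
         (subst (λ X → Goal ph′ pp′ X (length v)) (sym (trans (cong (λ x → V x (val a) v) c≡) (V-next a b w d v Y≡))) goal′))


V-start : ∀ w → V (+ 0) (+ 0) w ≡ + zval w
V-start w = zeros (+ fib (2 + length w)) (+ fib (1 + length w)) (+ zval w)
  where
  zeros : ∀ x y z → + 0 ℤ.* x ℤ.+ + 0 ℤ.* y ℤ.+ z ≡ z
  zeros = ℤ-Solver.solve-∀

carryNFA-sound : ∀ {w} → NAccepts carryNFA w → Σ (List Bool) λ ps → zval w ≡ 2 + lucasSum ps
carryNFA-sound {w} (_ , here refl , run) with sound run
... | ps , _ , V≡ = ps , trans (ℤ.+-injective (trans (sym (V-start w)) V≡)) (target-lucasSum false ps)
carryNFA-sound {w} (_ , there (here refl) , run) with sound run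
... | ps , _ , V≡ = ps , trans (ℤ.+-injective (trans (sym (V-start w)) V≡)) (target-lucasSum false ps)

carryNFA-complete : ∀ {w} ps → Linked NotBoth w → length w ≡ 2 + 2 * length ps ⊎ length w ≡ 3 + 2 * length ps →
                    zval w ≡ 2 + lucasSum ps → NAccepts carryNFA w
carryNFA-complete {w} ps shape length≡ value with length≡
... | inj₁ ℓ≡ = _ , here refl , complete w (λ ()) shape (ps , ℓ≡ , start-goal)
  where
  start-goal : V (+ 0) (+ 0) w ≡ + target false ps
  start-goal = trans (V-start w) (cong +_ (trans value (sym (target-lucasSum false ps))))
... | inj₂ ℓ≡ = _ , there (here refl) , complete w (λ ()) shape (ps , ℓ≡ , start-goal)
  where
  start-goal : V (+ 0) (+ 0) w ≡ + target false ps
  start-goal = trans (V-start w) (cong +_ (trans value (sym (target-lucasSum false ps))))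

long-enough : ∀ ℓ → 2 ≤ ℓ → Σ ℕ λ K → ℓ ≡ 2 + 2 * K ⊎ ℓ ≡ 3 + 2 * K
long-enough (suc zero) (s≤s ())
long-enough (suc (suc zero)) _ = 0 , inj₁ refl
long-enough (suc (suc (suc zero))) _ = 0 , inj₂ refl
long-enough (suc (suc (suc (suc ℓ)))) _ with long-enough (suc (suc ℓ)) (s≤s (s≤s z≤n))
... | K , inj₁ refl = suc K , inj₁ (cong (_+_ 2) (sym (*-suc 2 K)))
... | K , inj₂ refl = suc K , inj₂ (cong (_+_ 3) (sym (*-suc 2 K)))

-- An index i ≥ K + 2 would contribute L_{2i} ≥ F_{2i+1} ≥ F_{length w + 2} > zval w.
lucasIndices-below : ∀ {w is K} → Linked NotBoth w → length w ≤ 3 + 2 * K → All (2 ≤_) is →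
                     2 + sum (map (λ i → lucas (2 * i)) is) ≡ zval w → All (λ i → 2 ≤ i × i < K + 2) is
lucasIndices-below {w} {is} {K} shape ℓ≤ ≥2 value = All.zipWith (λ (2≤i , i<) → 2≤i , i<) (≥2 , All.tabulate below)
  where
  below : ∀ {i} → i ∈ is → i < K + 2
  below {zero} i∈ = ⊥-elim (<⇒≱ (s≤s z≤n) (All.lookup ≥2 i∈))
  below {suc i} i∈ = ≰⇒> λ K+2≤i → <-irrefl refl (begin-strict
    fib (2 + length w)                  ≤⟨ fib-mono (≤-trans (+-monoʳ-≤ 2 ℓ≤) (index≤ K+2≤i)) ⟩
    fib (suc (2 * suc i))               ≤⟨ fib≤lucas (i + suc (i + 0)) ⟩
    lucas (2 * suc i)                   ≤⟨ ∈⇒≤sum (∈-map⁺ (λ i → lucas (2 * i)) i∈) ⟩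
    sum (map (λ i → lucas (2 * i)) is)  <⟨ subst (sum (map (λ i → lucas (2 * i)) is) <_) value (m<n+m _ (s≤s z≤n)) ⟩
    zval w                              <⟨ zval-< shape ⟩
    fib (2 + length w)                  ∎)
    where
    open ≤-Reasoning
    double : ∀ K → 2 * (K + 2) ≡ 4 + 2 * K
    double = ℕ-Solver.solve-∀
    index≤ : K + 2 ≤ suc i → 2 + (3 + 2 * K) ≤ suc (2 * suc i)
    index≤ le = s≤s (subst (_≤ 2 * suc i) (double K) (*-monoʳ-≤ 2 le))

InU-zeckendorf⇒NAccepts : ∀ {w} → Linked NotBoth w → InU (zval w) → NAccepts carryNFA w
InU-zeckendorf⇒NAccepts {w} shape inU with InU⇒lucasIndices inU
... | is , unique , ≥2 , value with long-enough (length w) length≥2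
  where
  length≥2 : 2 ≤ length w
  length≥2 = ≮⇒≥ λ ℓ<2 → <⇒≱ (<-≤-trans (zval-< shape) (fib-mono {n = 3} (s≤s ℓ<2))) (subst (2 ≤_) value (m≤m+n 2 _))
...   | K , length≡ =
  carryNFA-complete (bitsOf is K) shape (subst (λ L → length w ≡ 2 + 2 * L ⊎ length w ≡ 3 + 2 * L) (sym (length-bitsOf is K)) length≡)
    (trans (sym value) (cong (_+_ 2) (sym (lucasSum-bitsOf K unique (lucasIndices-below shape ℓ≤ ≥2 value)))))
  where
  ℓ≤ : length w ≤ 3 + 2 * K
  ℓ≤ = [ (λ ℓ≡ → ≤-trans (≤-reflexive ℓ≡) (n≤1+n _)) , ≤-reflexive ]′ length≡

zeckU-dfa : DFA
zeckU-dfa = zeckShape ⊗ Determinise.dfa carryNFA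

Accepts-zeckU : ∀ w → Accepts zeckU-dfa w ⇔ ZeckU w
Accepts-zeckU w = mk⇔ forward backward
  where
  forward : Accepts zeckU-dfa w → ZeckU w
  forward acc = zval w , subst InU (sym (proj₂ value)) (lucasSum-InU (proj₁ value)) , proj₁ shape , proj₂ shape , refl
    where
    accs : Accepts zeckShape w × Accepts (Determinise.dfa carryNFA) w
    accs = to (Accepts-⊗ zeckShape (Determinise.dfa carryNFA) w) acc
    shape : NoLeadingZero w × Linked NotBoth w
    shape = to (Accepts-zeckShape w) (proj₁ accs)
    value : Σ (List Bool) λ ps → zval w ≡ 2 + lucasSum ps
    value = carryNFA-sound (to (Determinise.correct carryNFA w) (proj₂ accs))
  backward : ZeckU w → Accepts zeckU-dfa w
  backward (n , inU , nlz , linked , refl) =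
    from (Accepts-⊗ zeckShape (Determinise.dfa carryNFA) w)
      (from (Accepts-zeckShape w) (nlz , linked) , from (Determinise.correct carryNFA w) (InU-zeckendorf⇒NAccepts linked inU))

theorem8 : (Σ DFA λ D → (w : List Bool) → Accepts D w ⇔ ZeckU w)
    × ((n : ℕ) → InU n ⇔
         (Σ (List ℕ) λ is → Unique is × All (2 ≤_) is
            × 2 + sum (map (λ i → lucas (2 * i)) is) ≡ n))
    × ((n : ℕ) → InU n → (es : List ℤ) → IsPhiRep es n →
         (e : ℤ) → e ∈ es → T (oddℤ e) → e ≡ + 1)
theorem8 = (zeckU-dfa , Accepts-zeckU) , InU-lucasIndices , InU-odd-exponent
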